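{- Let $q$ be even and work over the field $\mathbb F_{q^2}$. Let $\ell,m$ be distinct non-tangent lines of the conic in $\mathrm{PG}(2,q^2)$ with $\hat\rho(\ell,m)=0$; then both lines are secant. For $i,j\in\{1,\dots,5\}$, let $p^4_{i,j}(1)$ be the number of non-tangent lines $n\notin\{\ell,m\}$ with $\hat\rho(\ell,n)\in\mathbf R_i$ and $\hat\rho(n,m)\in\mathbf R_j$. These numbers do not depend on the choice of $\ell,m$, and with $r=q^2-2q-1$ they are given by the symmetric matrix $(p^4_{i,j}(1))_{i,j=1}^5$: $$\begin{pmatrix}\frac{(q-2)(q-3)}2&\frac{q(q-2)}2&\frac{q(q-2)^2}2&q-2&0\\ \frac{q(q-2)}2&\frac{q(q-1)}2&\frac{q^2(q-2)}2&q&0\\ \frac{q(q-2)^2}2&\frac{q^2(q-2)}2&\frac{q(q-2)r}2&q(q-2)&0\\ q-2&q&q(q-2)&q^2-1&0\\0&0&0&0&\frac{q^2(q^2-1)}2\end{pmatrix}.$$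
   Context: Let $q$ be even and $Q=q^2$. Work in $\mathrm{PG}(2,Q)$. Conic and lines. - Points are nonzero vectors up to scalars, and $(a,b,c)^\perp$ denotes the line $aX+bY+cZ=0$. - The conic is $\mathcal O=\{(\xi,\xi^2,1)^\top:\xi\in\mathbb F_Q\}\cup\{(0,1,0)^\top\}$. - The non-tangent lines (meeting $\mathcal O$ in $0$ or $2$ points) are exactly the lines $(1,x,y)^\perp$, $x,y\in\mathbb F_Q$. - Such a line is secant if $\mathrm{Tr}(xy)=0$ and exterior if $\mathrm{Tr}(xy)=1$, where $\mathrm{Tr}$ is the absolute trace $\mathbb F_{q^2}\to\mathbb F_2$. Modified cross-ratio. - For $\ell=(1,x,y)^\perp$ and $n=(1,z,u)^\perp$: $\hat\rho(\ell,n)=x^2u^2+y^2z^2+(x+z)(y+u)$. The sets $\mathbf R_i$. - $\mathbf S_0$ is the set of elements of $\mathbb F_q$ with absolute trace $0$ (over $\mathbb F_2$), and $\mathbf S_1=\mathbb F_q\setminus\mathbf S_0$. - $\mathbf T_0$, $\mathbf T_1$ are the sets of elements of $\mathbb F_{q^2}$ of absolute trace $0$, $1$. - $\mathbf R_1=\mathbf S_0\setminus\{0\}$, $\mathbf R_2=\mathbf S_1$, $\mathbf R_3=\mathbf T_0\setminus\mathbb F_q$, $\mathbf R_4=\{0\}$, $\mathbf R_5=\mathbf T_1$. -}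

module Defs where

open import Data.Nat using (ℕ; zero; suc; _∸_; _/_) renaming (_+_ to _+ℕ_; _*_ to _*ℕ_; _^_ to _^ℕ_)
open import Data.Fin using (Fin; zero; suc)
open import Data.Bool using (Bool; true; false; _∧_; not)
open import Data.Product using (Σ; _×_; _,_)
open import Data.List using (List; length; filter; cartesianProduct)
open import Data.List.Membership.Propositional using (_∈_)
open import Data.List.Relation.Unary.Unique.Propositional using (Unique)
open import Relation.Nullary using (¬_; Dec; yes; no)
open import Relation.Nullary.Decidable using (⌊_⌋)
open import Relation.Unary using (Pred; Decidable)
open import Relation.Binary.PropositionalEquality using (_≡_; _≢_)
open import Algebra.Structures using (IsCommutativeRing)

record FiniteField : Set₁ where
  infixl 6 _+_
  infixl 7 _*_
  field
    Carrier : Set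
    _+_ _*_ : Carrier → Carrier → Carrier
    -_ : Carrier → Carrier
    0# 1# : Carrier
    isCommutativeRing : IsCommutativeRing _≡_ _+_ _*_ -_ 0# 1#
    1≢0 : 1# ≢ 0#
    inverse : ∀ x → x ≢ 0# → Σ Carrier (λ y → x * y ≡ 1#)
    _≟_ : (x y : Carrier) → Dec (x ≡ y)
    elements : List Carrier
    elements-unique : Unique elements
    elements-complete : ∀ x → x ∈ elements

  order : ℕ
  order = length elements

  pow : Carrier → ℕ → Carrier
  pow x zero    = 1#
  pow x (suc n) = x * pow x n

  traceSum : ℕ → Carrier → Carrier
  traceSum zero    x = 0#
  traceSum (suc n) x = traceSum n x + pow x (2 ^ℕ n)

-- Context for the theorem: F is a field of order Q = q^2 with q = 2^h, h ≥ 1.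
module Conic (F : FiniteField) (h : ℕ) where
  open FiniteField F

  q : ℕ
  q = 2 ^ℕ h

  inFq : Carrier → Set
  inFq x = pow x q ≡ x

  -- absolute trace F_{q^2} → F_2 (values in {0,1} ⊆ F)
  TrQ : Carrier → Carrier
  TrQ = traceSum (2 *ℕ h)

  -- absolute trace F_q → F_2 (meaningful for elements of F_q)
  Trq : Carrier → Carrier
  Trq = traceSum h

  -- a non-tangent line (1,x,y)^⊥ is represented by the pair (x,y)
  Line : Set
  Line = Carrier × Carrier

  Secant : Line → Set
  Secant (x , y) = TrQ (x * y) ≡ 0#

  Exterior : Line → Set
  Exterior (x , y) = TrQ (x * y) ≡ 1#

  ρ̂ : Line → Line → Carrier
  ρ̂ (x , y) (z , u) = pow x 2 * pow u 2 + pow y 2 * pow z 2 + (x + z) * (y + u)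

  -- the sets R_1, ..., R_5 (index i : Fin 5 stands for R_{i+1})
  R : Fin 5 → Carrier → Set
  R zero                         a = inFq a × Trq a ≡ 0# × a ≢ 0#
  R (suc zero)                   a = inFq a × Trq a ≢ 0#
  R (suc (suc zero))             a = TrQ a ≡ 0# × ¬ inFq a
  R (suc (suc (suc zero)))       a = a ≡ 0#
  R (suc (suc (suc (suc zero)))) a = TrQ a ≡ 1#

  private
    dec× : ∀ {A B : Set} → Dec A → Dec B → Dec (A × B)
    dec× (yes a) (yes b) = yes (a , b)
    dec× (no ¬a) _       = no (λ { (a , _) → ¬a a })
    dec× (yes _) (no ¬b) = no (λ { (_ , b) → ¬b b })

    dec¬ : ∀ {A : Set} → Dec A → Dec (¬ A)
    dec¬ (yes a) = no (λ ¬a → ¬a a)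
    dec¬ (no ¬a) = yes ¬a

    decLine : (a b : Line) → Dec (a ≡ b)
    decLine (x , y) (z , u) with x ≟ z | y ≟ u
    ... | yes _≡_.refl | yes _≡_.refl = yes _≡_.refl
    ... | no ne | _ = no (λ { _≡_.refl → ne _≡_.refl })
    ... | yes _ | no ne = no (λ { _≡_.refl → ne _≡_.refl })

  R? : (i : Fin 5) → Decidable (R i)
  R? zero a = dec× (pow a q ≟ a) (dec× (Trq a ≟ 0#) (dec¬ (a ≟ 0#)))
  R? (suc zero) a = dec× (pow a q ≟ a) (dec¬ (Trq a ≟ 0#))
  R? (suc (suc zero)) a = dec× (TrQ a ≟ 0#) (dec¬ (pow a q ≟ a))
  R? (suc (suc (suc zero))) a = a ≟ 0#
  R? (suc (suc (suc (suc zero)))) a = TrQ a ≟ 1#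

  lines : List Line
  lines = cartesianProduct elements elements

  count : Line → Line → Fin 5 → Fin 5 → ℕ
  count ℓ m i j = length (filter P? lines)
    where
      P : Line → Set
      P n = n ≢ ℓ × n ≢ m × R i (ρ̂ ℓ n) × R j (ρ̂ n m)
      P? : Decidable P
      P? n = dec× (dec¬ (decLine n ℓ)) (dec× (dec¬ (decLine n m))
               (dec× (R? i (ρ̂ ℓ n)) (R? j (ρ̂ n m))))

-- the matrix (p^4_{i,j}(1)) as a function of q, with r = q^2 - 2q - 1
-- (truncated subtraction; all arguments of ∸ are nonnegative for q ≥ 4,
--  and for q = 2 every affected entry has the factor q - 2 = 0)
pMatrix : ℕ → Fin 5 → Fin 5 → ℕ
pMatrix q = M
  where
    r : ℕ
    r = q *ℕ q ∸ 2 *ℕ q ∸ 1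
    M : Fin 5 → Fin 5 → ℕ
    M zero zero = ((q ∸ 2) *ℕ (q ∸ 3)) / 2
    M zero (suc zero) = (q *ℕ (q ∸ 2)) / 2
    M zero (suc (suc zero)) = (q *ℕ ((q ∸ 2) *ℕ (q ∸ 2))) / 2
    M zero (suc (suc (suc zero))) = q ∸ 2
    M zero (suc (suc (suc (suc zero)))) = 0
    M (suc zero) zero = (q *ℕ (q ∸ 2)) / 2
    M (suc zero) (suc zero) = (q *ℕ (q ∸ 1)) / 2
    M (suc zero) (suc (suc zero)) = ((q *ℕ q) *ℕ (q ∸ 2)) / 2
    M (suc zero) (suc (suc (suc zero))) = q
    M (suc zero) (suc (suc (suc (suc zero)))) = 0
    M (suc (suc zero)) zero = (q *ℕ ((q ∸ 2) *ℕ (q ∸ 2))) / 2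
    M (suc (suc zero)) (suc zero) = ((q *ℕ q) *ℕ (q ∸ 2)) / 2
    M (suc (suc zero)) (suc (suc zero)) = (q *ℕ (q ∸ 2) *ℕ r) / 2
    M (suc (suc zero)) (suc (suc (suc zero))) = q *ℕ (q ∸ 2)
    M (suc (suc zero)) (suc (suc (suc (suc zero)))) = 0
    M (suc (suc (suc zero))) zero = q ∸ 2
    M (suc (suc (suc zero))) (suc zero) = q
    M (suc (suc (suc zero))) (suc (suc zero)) = q *ℕ (q ∸ 2)
    M (suc (suc (suc zero))) (suc (suc (suc zero))) = q *ℕ q ∸ 1
    M (suc (suc (suc zero))) (suc (suc (suc (suc zero)))) = 0
    M (suc (suc (suc (suc zero)))) zero = 0
    M (suc (suc (suc (suc zero)))) (suc zero) = 0
    M (suc (suc (suc (suc zero)))) (suc (suc zero)) = 0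
    M (suc (suc (suc (suc zero)))) (suc (suc (suc zero))) = 0
    M (suc (suc (suc (suc zero)))) (suc (suc (suc (suc zero)))) = ((q *ℕ q) *ℕ (q *ℕ q ∸ 1)) / 2

-- Writing the non-tangent line (1,x,y)^⊥ as the pair (x, y): for ℓ ≠ m with ρ̂(ℓ, m) = 0 there is
-- a bijection n ↦ (t, v) of the lines sending ℓ, m to (0, 0), (0, 1) with ρ̂(ℓ, n) = t v and
-- ρ̂(n, m) = t v + t² + t; the same relation makes x y = c² + c for each of ℓ, m, so both are secant.
-- Hence p⁴ᵢⱼ(1) counts the (t, v) ∉ {(0, 0), (0, 1)} with t v ∈ Rᵢ and t v + t² + t ∈ Rⱼ. For t ≠ 0
-- put α = t v. The map t ↦ t² + t is two-to-one onto the trace-zero elements, and for α ∈ Rᵢ the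
-- translate α + T₀ contains Rⱼ if Rᵢ and Rⱼ have the same trace and misses it otherwise. Summing
-- over all t, where the term t = 0 is |Rᵢ ∩ Rⱼ|, gives
--   p⁴ᵢⱼ(1) + [i = j] |Rᵢ| = [i = j = 4] (Q - 2) + 2 [Tr Rᵢ = Tr Rⱼ] |Rᵢ| |Rⱼ|.
-- The sizes |R₁|, …, |R₅| = q/2 - 1, q/2, Q/2 - q, 1, Q/2 follow from root counts: the trace
-- polynomials of degree q/2 and Q/2, and x^q + x, have at most as many roots as their degree.

module Submission where

open import Defs
open import Data.Nat using (ℕ; _≥_; _^_; suc; s≤s; z≤n) renaming (_*_ to _*ℕ_)
import Data.Nat.Properties as ℕ
open import Data.Fin as Fin using (Fin; zero; suc)
open import Data.Bool as Bool using (Bool; true; false)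
open import Data.Product using (_×_; _,_; proj₁; proj₂)
open import Relation.Binary.PropositionalEquality using (_≡_; _≢_; refl; trans; cong)

-- Finite sums and counting

module Sums where
  open import Algebra.Bundles using (CommutativeMonoid)
  open import Algebra.Core using (Op₂)
  open import Algebra.Structures using (IsCommutativeMonoid)
  open import Data.List using (List; []; _∷_; _++_; map; foldr; cartesianProduct; length; filter)
  open import Data.List.Properties using (map-∘)
  open import Data.List.Membership.Propositional using (_∈_; _∉_)
  open import Data.List.Membership.Propositional.Properties using (∈-map⁺)
  open import Data.List.Membership.Propositional.Properties.WithK using (unique∧set⇒bag)
  open import Data.List.Relation.Binary.BagAndSetEquality using (∼bag⇒↭)
  open import Data.List.Relation.Binary.Permutation.Propositional using (_↭_; ↭⇒↭ₛ)
  import Data.List.Relation.Binary.Permutation.Propositional.Properties as ↭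
  open import Data.List.Relation.Binary.Permutation.Setoid.Properties using (foldr-commMonoid)
  open import Data.List.Relation.Unary.All as All using ()
  open import Data.List.Relation.Unary.AllPairs using (_∷_)
  open import Data.List.Relation.Unary.Any using (here; there)
  open import Data.List.Relation.Unary.Unique.Propositional using (Unique)
  import Data.List.Relation.Unary.Unique.Propositional.Properties as Unique
  open import Data.Nat using (_+_; _*_; _≤_)
  open import Data.Empty using (⊥-elim)
  open import Function using (_∘_; id; mk⇔)
  open import Relation.Nullary using (Dec; yes; no; _×-dec_)
  open import Relation.Unary using (Decidable)
  open import Relation.Binary.Definitions using (DecidableEquality)
  open import Relation.Binary.PropositionalEquality

  module FiniteSum {M : Set} {_∙_ : Op₂ M} {ε : M} (isCM : IsCommutativeMonoid _≡_ _∙_ ε) where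
    open IsCommutativeMonoid isCM using (assoc; identityˡ)

    private
      commutativeMonoid : CommutativeMonoid _ _
      commutativeMonoid = record { isCommutativeMonoid = isCM }

    open import Algebra.Properties.CommutativeSemigroup (CommutativeMonoid.commutativeSemigroup commutativeMonoid)
      using (interchange)

    ∑ : {A : Set} → List A → (A → M) → M
    ∑ xs w = foldr _∙_ ε (map w xs)

    ∑-cong : {A : Set} (xs : List A) {v w : A → M} → (∀ x → x ∈ xs → v x ≡ w x) → ∑ xs v ≡ ∑ xs w
    ∑-cong []       e = refl
    ∑-cong (x ∷ xs) e = cong₂ _∙_ (e x (here refl)) (∑-cong xs (λ y y∈xs → e y (there y∈xs)))

    ∑-ε : {A : Set} (xs : List A) → ∑ xs (λ _ → ε) ≡ ε
    ∑-ε []       = refl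
    ∑-ε (x ∷ xs) = trans (identityˡ _) (∑-ε xs)

    ∑-++ : {A : Set} (xs ys : List A) (w : A → M) → ∑ (xs ++ ys) w ≡ ∑ xs w ∙ ∑ ys w
    ∑-++ []       ys w = sym (identityˡ _)
    ∑-++ (x ∷ xs) ys w = trans (cong (w x ∙_) (∑-++ xs ys w)) (sym (assoc _ _ _))

    ∑-map : {A B : Set} (f : A → B) (xs : List A) (w : B → M) → ∑ (map f xs) w ≡ ∑ xs (w ∘ f)
    ∑-map f xs w = cong (foldr _∙_ ε) (sym (map-∘ xs))

    ∑-distrib : {A : Set} (xs : List A) (v w : A → M) → ∑ xs (λ x → v x ∙ w x) ≡ ∑ xs v ∙ ∑ xs w
    ∑-distrib []       v w = sym (identityˡ ε)
    ∑-distrib (x ∷ xs) v w = begin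
      (v x ∙ w x) ∙ ∑ xs (λ y → v y ∙ w y) ≡⟨ cong ((v x ∙ w x) ∙_) (∑-distrib xs v w) ⟩
      (v x ∙ w x) ∙ (∑ xs v ∙ ∑ xs w)      ≡⟨ interchange (v x) (w x) _ _ ⟩
      (v x ∙ ∑ xs v) ∙ (w x ∙ ∑ xs w)      ∎
      where open ≡-Reasoning

    ∑-swap : {A B : Set} (xs : List A) (ys : List B) (w : A → B → M) →
      ∑ xs (λ x → ∑ ys (w x)) ≡ ∑ ys (λ y → ∑ xs (λ x → w x y))
    ∑-swap []       ys w = sym (∑-ε ys)
    ∑-swap (x ∷ xs) ys w =
      trans (cong (∑ ys (w x) ∙_) (∑-swap xs ys w)) (sym (∑-distrib ys (w x) _))

    ∑-cartesianProduct : {A B : Set} (xs : List A) (ys : List B) (w : A × B → M) →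
      ∑ (cartesianProduct xs ys) w ≡ ∑ xs (λ x → ∑ ys (λ y → w (x , y)))
    ∑-cartesianProduct []       ys w = refl
    ∑-cartesianProduct (x ∷ xs) ys w = trans (∑-++ (map (x ,_) ys) _ w)
      (cong₂ _∙_ (∑-map (x ,_) ys w) (∑-cartesianProduct xs ys w))

    ∑-↭ : {A : Set} {xs ys : List A} (w : A → M) → xs ↭ ys → ∑ xs w ≡ ∑ ys w
    ∑-↭ w p = foldr-commMonoid (setoid _) isCM (↭⇒↭ₛ (↭.map⁺ w p))

    ∑-reindex : {A : Set} {xs : List A} → Unique xs → (∀ a → a ∈ xs) →
      (f g : A → A) → g ∘ f ≗ id → f ∘ g ≗ id → (w : A → M) → ∑ xs (w ∘ f) ≡ ∑ xs w
    ∑-reindex {xs = xs} unique complete f g gf fg w =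
      trans (sym (∑-map f xs w)) (∑-↭ w (∼bag⇒↭ (unique∧set⇒bag unique-f unique (mk⇔ (λ _ → complete _) image))))
      where
      unique-f : Unique (map f xs)
      unique-f = Unique.map⁺ (λ {a} {b} e → trans (sym (gf a)) (trans (cong g e) (gf b))) unique
      image : ∀ {a} → a ∈ xs → a ∈ map f xs
      image {a} _ = subst (_∈ map f xs) (fg a) (∈-map⁺ f (complete (g a)))


  open FiniteSum ℕ.+-0-isCommutativeMonoid public

  χ : {P : Set} → Dec P → ℕ
  χ (yes _) = 1
  χ (no _)  = 0

  χ-cong : {P Q : Set} (p : Dec P) (q : Dec Q) → (P → Q) → (Q → P) → χ p ≡ χ q
  χ-cong (yes _) (yes _) _  _  = refl
  χ-cong (yes p) (no ¬q) pq _  = ⊥-elim (¬q (pq p))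
  χ-cong (no ¬p) (yes q) _  qp = ⊥-elim (¬p (qp q))
  χ-cong (no _)  (no _)  _  _  = refl

  χ-mono : {P Q : Set} (p : Dec P) (q : Dec Q) → (P → Q) → χ p ≤ χ q
  χ-mono (yes p) (yes _) _  = s≤s z≤n
  χ-mono (yes p) (no ¬q) pq = ⊥-elim (¬q (pq p))
  χ-mono (no _)  _       _  = z≤n

  length-filter≡∑χ : {A : Set} {P : A → Set} (P? : Decidable P) (xs : List A) →
    length (filter P? xs) ≡ ∑ xs (λ x → χ (P? x))
  length-filter≡∑χ P? []       = refl
  length-filter≡∑χ P? (x ∷ xs) with P? x
  ... | yes _ = cong suc (length-filter≡∑χ P? xs)
  ... | no  _ = length-filter≡∑χ P? xs

  ∑-const : {A : Set} (xs : List A) (c : ℕ) → ∑ xs (λ _ → c) ≡ length xs * c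
  ∑-const []       c = refl
  ∑-const (x ∷ xs) c = cong (c +_) (∑-const xs c)

  ∑-*-distribˡ : {A : Set} (xs : List A) (c : ℕ) (w : A → ℕ) → ∑ xs (λ x → c * w x) ≡ c * ∑ xs w
  ∑-*-distribˡ []       c w = sym (ℕ.*-zeroʳ c)
  ∑-*-distribˡ (x ∷ xs) c w =
    trans (cong (c * w x +_) (∑-*-distribˡ xs c w)) (sym (ℕ.*-distribˡ-+ c (w x) _))

  ∑-*-distribʳ : {A : Set} (xs : List A) (c : ℕ) (w : A → ℕ) → ∑ xs (λ x → w x * c) ≡ ∑ xs w * c
  ∑-*-distribʳ xs c w = trans (∑-cong xs (λ x _ → ℕ.*-comm (w x) c)) (trans (∑-*-distribˡ xs c w) (ℕ.*-comm c _))

  χ-× : {P Q : Set} (p : Dec P) (q : Dec Q) → χ (p ×-dec q) ≡ χ p * χ q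
  χ-× (yes _) (yes _) = refl
  χ-× (yes _) (no  _) = refl
  χ-× (no  _) _       = refl

  ∑-mono-≤ : {A : Set} (xs : List A) {v w : A → ℕ} → (∀ x → x ∈ xs → v x ≤ w x) → ∑ xs v ≤ ∑ xs w
  ∑-mono-≤ []       _  = z≤n
  ∑-mono-≤ (x ∷ xs) le = ℕ.+-mono-≤ (le x (here refl)) (∑-mono-≤ xs (λ y y∈xs → le y (there y∈xs)))

  ∑-≤-≡⇒≡ : {A : Set} (xs : List A) {v w : A → ℕ} → (∀ x → x ∈ xs → v x ≤ w x) →
    ∑ xs v ≡ ∑ xs w → ∀ x → x ∈ xs → v x ≡ w x
  ∑-≤-≡⇒≡ (y ∷ xs) {v} {w} le eq x x∈ = go x∈
    where
    le-tail : ∀ z → z ∈ xs → v z ≤ w z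
    le-tail z z∈ = le z (there z∈)
    vy≡wy : v y ≡ w y
    vy≡wy = ℕ.≤-antisym (le y (here refl))
      (ℕ.+-cancelʳ-≤ (∑ xs v) (w y) (v y) (begin
        w y + ∑ xs v ≤⟨ ℕ.+-monoʳ-≤ (w y) (∑-mono-≤ xs le-tail) ⟩
        w y + ∑ xs w ≡⟨ sym eq ⟩
        v y + ∑ xs v ∎))
      where open ℕ.≤-Reasoning
    go : x ∈ y ∷ xs → v x ≡ w x
    go (here refl) = vy≡wy
    go (there x∈xs) = ∑-≤-≡⇒≡ xs le-tail (ℕ.+-cancelˡ-≡ (w y) _ _ (trans (cong (_+ ∑ xs v) (sym vy≡wy)) eq)) x x∈xs

  module _ {A : Set} (_≟_ : DecidableEquality A) where

    ∑-∉ : {xs : List A} {a : A} (f : A → ℕ) → a ∉ xs → ∑ xs (λ y → χ (y ≟ a) * f y) ≡ 0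
    ∑-∉ {[]}     f a∉ = refl
    ∑-∉ {y ∷ xs} {a} f a∉ with y ≟ a
    ... | yes refl = ⊥-elim (a∉ (here refl))
    ... | no _     = ∑-∉ f (λ a∈ → a∉ (there a∈))

    ∑-pointMass : {xs : List A} {a : A} (f : A → ℕ) → Unique xs → a ∈ xs → ∑ xs (λ y → χ (y ≟ a) * f y) ≡ f a
    ∑-pointMass {y ∷ xs} {a} f (y∉ ∷ unique) a∈ with y ≟ a | a∈
    ... | yes refl | _          =
      trans (cong₂ _+_ (ℕ.+-identityʳ (f a)) (∑-∉ f (λ a∈xs → All.lookup y∉ a∈xs refl))) (ℕ.+-identityʳ (f a))
    ... | no y≢a   | here y≡a   = ⊥-elim (y≢a (sym y≡a))
    ... | no _     | there a∈xs = ∑-pointMass f unique a∈xs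

  halves : ∀ {a b d} → a ≤ d → b ≤ d → a + b ≡ d + d → a ≡ d × b ≡ d
  halves {a} {b} {d} a≤d b≤d a+b≡d+d = a≡d , ℕ.+-cancelˡ-≡ d b d (trans (cong (_+ b) (sym a≡d)) a+b≡d+d)
    where
    a≡d : a ≡ d
    a≡d = ℕ.≤-antisym a≤d (ℕ.+-cancelʳ-≤ b d a (ℕ.≤-trans (ℕ.+-monoʳ-≤ d b≤d) (ℕ.≤-reflexive (sym a+b≡d+d))))

open Sums

-- Defs numbers R₁, …, R₅ from zero; ιₖ is the index of Rₖ.
pattern ι₁ = zero
pattern ι₂ = suc zero
pattern ι₃ = suc ι₂
pattern ι₄ = suc ι₃
pattern ι₅ = suc ι₄

isι₅ : Fin 5 → Bool
isι₅ ι₅ = true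
isι₅ _  = false

-- Counting in a finite field

module Counting (F : FiniteField) where
  open import Data.Nat using (_≤_) renaming (_+_ to _+ℕ_)
  open import Function using (_∘_)
  open import Relation.Nullary using (Dec; yes; no; ¬?; _×-dec_)
  open import Relation.Unary using (Decidable)
  open import Relation.Binary.PropositionalEquality

  open FiniteField F

  ∑𝔽 : (Carrier → ℕ) → ℕ
  ∑𝔽 = ∑ elements

  ∑𝔽-reindex : (f g : Carrier → Carrier) → (∀ x → g (f x) ≡ x) → (∀ x → f (g x) ≡ x) →
    (w : Carrier → ℕ) → ∑𝔽 (w ∘ f) ≡ ∑𝔽 w
  ∑𝔽-reindex = ∑-reindex elements-unique elements-complete

  #[_] : {P : Carrier → Set} → Decidable P → ℕ
  #[ P? ] = ∑𝔽 (λ x → χ (P? x))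

  #-cong : {P Q : Carrier → Set} (P? : Decidable P) (Q? : Decidable Q) →
    (∀ {x} → P x → Q x) → (∀ {x} → Q x → P x) → #[ P? ] ≡ #[ Q? ]
  #-cong P? Q? PQ QP = ∑-cong elements (λ x _ → χ-cong (P? x) (Q? x) PQ QP)

  #-mono : {P Q : Carrier → Set} (P? : Decidable P) (Q? : Decidable Q) → (∀ {x} → P x → Q x) → #[ P? ] ≤ #[ Q? ]
  #-mono P? Q? PQ = ∑-mono-≤ elements (λ x _ → χ-mono (P? x) (Q? x) PQ)

  #-split : {P Q : Carrier → Set} (P? : Decidable P) (Q? : Decidable Q) →
    #[ (λ x → P? x ×-dec Q? x) ] +ℕ #[ (λ x → P? x ×-dec ¬? (Q? x)) ] ≡ #[ P? ]
  #-split P? Q? = trans (sym (∑-distrib elements _ _)) (∑-cong elements (λ x _ → split (P? x) (Q? x)))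
    where
    split : ∀ {A B : Set} (a : Dec A) (b : Dec B) → χ (a ×-dec b) +ℕ χ (a ×-dec ¬? b) ≡ χ a
    split (yes _) (yes _) = refl
    split (yes _) (no  _) = refl
    split (no  _) (yes _) = refl
    split (no  _) (no  _) = refl

  #-≟ : ∀ a → #[ _≟ a ] ≡ 1
  #-≟ a = trans (∑-cong elements (λ x _ → sym (ℕ.*-identityʳ _)))
    (∑-pointMass _≟_ (λ _ → 1) elements-unique (elements-complete a))

  order≡∑𝔽1 : order ≡ ∑𝔽 (λ _ → 1)
  order≡∑𝔽1 = sym (trans (∑-const elements 1) (ℕ.*-identityʳ _))

  #-complement : {P : Carrier → Set} (P? : Decidable P) → #[ P? ] +ℕ #[ ¬? ∘ P? ] ≡ order
  #-complement P? = trans (sym (∑-distrib elements _ _)) (trans (∑-cong elements (λ x _ → split (P? x))) (sym order≡∑𝔽1))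
    where
    split : ∀ {A : Set} (a : Dec A) → χ a +ℕ χ (¬? a) ≡ 1
    split (yes _) = refl
    split (no  _) = refl

  ∑𝔽-∘ : (f : Carrier → Carrier) (w : Carrier → ℕ) → ∑𝔽 (w ∘ f) ≡ ∑𝔽 (λ c → #[ (λ x → f x ≟ c) ] *ℕ w c)
  ∑𝔽-∘ f w = begin
    ∑𝔽 (w ∘ f)                               ≡⟨ ∑-cong elements (λ x _ → sym (∑-pointMass _≟_ w elements-unique (elements-complete (f x)))) ⟩
    ∑𝔽 (λ x → ∑𝔽 (λ c → χ (c ≟ f x) *ℕ w c)) ≡⟨ ∑-swap elements elements _ ⟩
    ∑𝔽 (λ c → ∑𝔽 (λ x → χ (c ≟ f x) *ℕ w c)) ≡⟨ ∑-cong elements (λ c _ → ∑-cong elements (λ x _ → cong (_*ℕ w c) (χ-cong (c ≟ f x) (f x ≟ c) sym sym))) ⟩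
    ∑𝔽 (λ c → ∑𝔽 (λ x → χ (f x ≟ c) *ℕ w c)) ≡⟨ ∑-cong elements (λ c _ → ∑-*-distribʳ elements (w c) _) ⟩
    ∑𝔽 (λ c → #[ (λ x → f x ≟ c) ] *ℕ w c)   ∎
    where open ≡-Reasoning

  ∑𝔽-fibres : (f : Carrier → Carrier) → ∑𝔽 (λ c → #[ (λ x → f x ≟ c) ]) ≡ order
  ∑𝔽-fibres f = begin
    ∑𝔽 (λ c → #[ (λ x → f x ≟ c) ])      ≡⟨ ∑-cong elements (λ c _ → sym (ℕ.*-identityʳ _)) ⟩
    ∑𝔽 (λ c → #[ (λ x → f x ≟ c) ] *ℕ 1) ≡⟨ sym (∑𝔽-∘ f (λ _ → 1)) ⟩
    ∑𝔽 (λ _ → 1)                         ≡⟨ sym order≡∑𝔽1 ⟩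
    order                                ∎
    where open ≡-Reasoning

  ∑𝔽-except : ∀ a (f g : Carrier → ℕ) → (∀ t → t ≢ a → f t ≡ g t) → ∑𝔽 f +ℕ g a ≡ f a +ℕ ∑𝔽 g
  ∑𝔽-except a f g f≡g = begin
    ∑𝔽 f +ℕ g a                         ≡⟨ cong (∑𝔽 f +ℕ_) (sym (pointMass g)) ⟩
    ∑𝔽 f +ℕ ∑𝔽 (λ t → χ (t ≟ a) *ℕ g t) ≡⟨ sym (∑-distrib elements _ _) ⟩
    ∑𝔽 (λ t → f t +ℕ χ (t ≟ a) *ℕ g t)  ≡⟨ ∑-cong elements (λ t _ → swap t (t ≟ a)) ⟩
    ∑𝔽 (λ t → χ (t ≟ a) *ℕ f t +ℕ g t)  ≡⟨ ∑-distrib elements _ _ ⟩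
    ∑𝔽 (λ t → χ (t ≟ a) *ℕ f t) +ℕ ∑𝔽 g ≡⟨ cong (_+ℕ ∑𝔽 g) (pointMass f) ⟩
    f a +ℕ ∑𝔽 g                         ∎
    where
    open ≡-Reasoning
    pointMass : ∀ w → ∑𝔽 (λ t → χ (t ≟ a) *ℕ w t) ≡ w a
    pointMass w = ∑-pointMass _≟_ w elements-unique (elements-complete a)
    swap : ∀ t (t≟a : Dec (t ≡ a)) → f t +ℕ χ t≟a *ℕ g t ≡ χ t≟a *ℕ f t +ℕ g t
    swap t (yes refl) = trans (cong (f t +ℕ_) (ℕ.+-identityʳ (g t))) (cong (_+ℕ g t) (sym (ℕ.+-identityʳ (f t))))
    swap t (no  t≢a)  = trans (ℕ.+-identityʳ (f t)) (f≡g t t≢a)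

-- Finite fields of characteristic two

module CharacteristicTwo (F : FiniteField) (char2 : FiniteField._+_ F (FiniteField.1# F) (FiniteField.1# F) ≡ FiniteField.0# F) where
  open import Data.Bool using (_xor_; _∧_)
  open import Data.Empty using (⊥-elim)
  open import Data.List using (List; []; _∷_)
  open import Data.List.Membership.Propositional using (_∈_)
  open import Data.List.Relation.Unary.All as All using ()
  open import Data.List.Relation.Unary.AllPairs using (_∷_)
  open import Data.List.Relation.Unary.Unique.Propositional using (Unique)
  open import Data.Maybe using (Maybe; just; nothing)
  open import Data.Nat using (zero; pred; _≤_; NonZero; ≢-nonZero⁻¹) renaming (_+_ to _+ℕ_)
  open import Data.Product using (Σ)
  open import Data.Sum using (_⊎_; inj₁; inj₂)
  open import Function using (_∘_)
  open import Relation.Nullary using (yes; no; ¬?)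
  open import Relation.Binary.PropositionalEquality
  open import Algebra.Bundles using (RawRing)
  open import Algebra.Structures using (IsCommutativeRing)
  open import Algebra.Solver.Ring.AlmostCommutativeRing using (AlmostCommutativeRing; fromCommutativeRing; _-Raw-AlmostCommutative⟶_)

  open FiniteField F
  open Counting F
  open IsCommutativeRing isCommutativeRing
    using (+-identityˡ; +-identityʳ; +-assoc; +-comm; *-identityˡ; *-identityʳ; *-assoc; *-comm;
           zeroˡ; zeroʳ; -‿inverseˡ; *-isCommutativeMonoid)

  fromBool : Bool → Carrier
  fromBool true  = 1#
  fromBool false = 0#

  -- Ring identities are normalised with coefficients in 𝔽₂ = (Bool, xor, ∧),
  -- so that x + x = 0 is available to the solver.
  private
    almostCommutativeRing : AlmostCommutativeRing _ _
    almostCommutativeRing = fromCommutativeRing (record { isCommutativeRing = isCommutativeRing })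

    𝔽₂ : RawRing _ _
    𝔽₂ = record { Carrier = Bool ; _≈_ = _≡_ ; _+_ = _xor_ ; _*_ = _∧_ ; -_ = λ b → b ; 0# = false ; 1# = true }

    -1#≡1# : - 1# ≡ 1#
    -1#≡1# = begin
      - 1#             ≡⟨ sym (+-identityʳ (- 1#)) ⟩
      - 1# + 0#        ≡⟨ cong (- 1# +_) (sym char2) ⟩
      - 1# + (1# + 1#) ≡⟨ sym (+-assoc (- 1#) 1# 1#) ⟩
      (- 1# + 1#) + 1# ≡⟨ cong (_+ 1#) (-‿inverseˡ 1#) ⟩
      0# + 1#          ≡⟨ +-identityˡ 1# ⟩
      1#               ∎
      where open ≡-Reasoning

    fromBool-homomorphism : 𝔽₂ -Raw-AlmostCommutative⟶ almostCommutativeRing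
    fromBool-homomorphism = record
      { ⟦_⟧ = fromBool ; +-homo = +-homo ; *-homo = *-homo ; -‿homo = -‿homo ; 0-homo = refl ; 1-homo = refl }
      where
      +-homo : ∀ a b → fromBool (a xor b) ≡ fromBool a + fromBool b
      +-homo false false = sym (+-identityˡ 0#)
      +-homo false true  = sym (+-identityˡ 1#)
      +-homo true  false = sym (+-identityʳ 1#)
      +-homo true  true  = sym char2
      *-homo : ∀ a b → fromBool (a ∧ b) ≡ fromBool a * fromBool b
      *-homo false b = sym (zeroˡ (fromBool b))
      *-homo true  b = sym (*-identityˡ (fromBool b))
      -‿homo : ∀ a → fromBool a ≡ - fromBool a
      -‿homo false = sym (trans (sym (+-identityʳ (- 0#))) (-‿inverseˡ 0#))
      -‿homo true  = sym -1#≡1#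

    fromBool-≟ : ∀ a b → Maybe (fromBool a ≡ fromBool b)
    fromBool-≟ false false = just refl
    fromBool-≟ true  true  = just refl
    fromBool-≟ _     _     = nothing

  open import Algebra.Solver.Ring 𝔽₂ almostCommutativeRing
    fromBool-homomorphism fromBool-≟ public using (solve; _:=_; _:+_; _:*_; con)

  x+x≡0 : ∀ x → x + x ≡ 0#
  x+x≡0 = solve 1 (λ x → x :+ x := con false) refl

  x+y≡0⇒x≡y : ∀ {x y} → x + y ≡ 0# → x ≡ y
  x+y≡0⇒x≡y {x} {y} e =
    trans (solve 2 (λ x y → x := y :+ (x :+ y)) refl x y) (trans (cong (y +_) e) (+-identityʳ y))

  x≡y⇒x+y≡0 : ∀ {x y} → x ≡ y → x + y ≡ 0#
  x≡y⇒x+y≡0 {x} refl = x+x≡0 x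

  0≢1 : 0# ≢ 1#
  0≢1 e = 1≢0 (sym e)

  fromBool-injective : ∀ {a b} → fromBool a ≡ fromBool b → a ≡ b
  fromBool-injective {false} {false} _ = refl
  fromBool-injective {false} {true}  e = ⊥-elim (0≢1 e)
  fromBool-injective {true}  {false} e = ⊥-elim (1≢0 e)
  fromBool-injective {true}  {true}  _ = refl

  inv : (x : Carrier) → x ≢ 0# → Carrier
  inv x x≢0 = proj₁ (inverse x x≢0)

  *-inverseʳ : (x : Carrier) (x≢0 : x ≢ 0#) → x * inv x x≢0 ≡ 1#
  *-inverseʳ x x≢0 = proj₂ (inverse x x≢0)

  inv-*-cancelˡ : (x : Carrier) (x≢0 : x ≢ 0#) → ∀ y → inv x x≢0 * (x * y) ≡ y
  inv-*-cancelˡ x x≢0 y = begin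
    inv x x≢0 * (x * y) ≡⟨ solve 3 (λ i x y → i :* (x :* y) := (x :* i) :* y) refl (inv x x≢0) x y ⟩
    (x * inv x x≢0) * y ≡⟨ cong (_* y) (*-inverseʳ x x≢0) ⟩
    1# * y              ≡⟨ *-identityˡ y ⟩
    y                   ∎
    where open ≡-Reasoning

  *-inv-cancelˡ : (x : Carrier) (x≢0 : x ≢ 0#) → ∀ y → x * (inv x x≢0 * y) ≡ y
  *-inv-cancelˡ x x≢0 y = trans (sym (*-assoc _ _ _)) (trans (cong (_* y) (*-inverseʳ x x≢0)) (*-identityˡ y))

  x*y≡0⇒x≡0⊎y≡0 : ∀ {x y} → x * y ≡ 0# → x ≡ 0# ⊎ y ≡ 0#
  x*y≡0⇒x≡0⊎y≡0 {x} {y} e with x ≟ 0#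
  ... | yes x≡0 = inj₁ x≡0
  ... | no  x≢0 = inj₂ (trans (sym (inv-*-cancelˡ x x≢0 y)) (trans (cong (inv x x≢0 *_) e) (zeroʳ _)))

  *-≢0 : ∀ {x y} → x ≢ 0# → y ≢ 0# → x * y ≢ 0#
  *-≢0 x≢0 y≢0 e with x*y≡0⇒x≡0⊎y≡0 e
  ... | inj₁ x≡0 = x≢0 x≡0
  ... | inj₂ y≡0 = y≢0 y≡0

  x*x≡0⇒x≡0 : ∀ {x} → x * x ≡ 0# → x ≡ 0#
  x*x≡0⇒x≡0 e with x*y≡0⇒x≡0⊎y≡0 e
  ... | inj₁ x≡0 = x≡0
  ... | inj₂ x≡0 = x≡0

  *-cancelˡ : ∀ {x y z} → x ≢ 0# → x * y ≡ x * z → y ≡ z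
  *-cancelˡ {x} {y} {z} x≢0 e
    with x*y≡0⇒x≡0⊎y≡0 (trans (solve 3 (λ x y z → x :* (y :+ z) := x :* y :+ x :* z) refl x y z) (x≡y⇒x+y≡0 e))
  ... | inj₁ x≡0   = ⊥-elim (x≢0 x≡0)
  ... | inj₂ y+z≡0 = x+y≡0⇒x≡y y+z≡0

  x*x≡x⇒x≡0⊎x≡1 : ∀ {x} → x * x ≡ x → x ≡ 0# ⊎ x ≡ 1#
  x*x≡x⇒x≡0⊎x≡1 {x} e
    with x*y≡0⇒x≡0⊎y≡0 (trans (solve 1 (λ x → x :* (x :+ con true) := x :* x :+ x) refl x) (x≡y⇒x+y≡0 e))
  ... | inj₁ x≡0   = inj₁ x≡0
  ... | inj₂ x+1≡0 = inj₂ (x+y≡0⇒x≡y x+1≡0)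

  pow-distribˡ-+ : ∀ x m n → pow x (m +ℕ n) ≡ pow x m * pow x n
  pow-distribˡ-+ x zero    n = sym (*-identityˡ _)
  pow-distribˡ-+ x (suc m) n = trans (cong (x *_) (pow-distribˡ-+ x m n)) (sym (*-assoc _ _ _))

  pow-distribʳ-* : ∀ x y n → pow (x * y) n ≡ pow x n * pow y n
  pow-distribʳ-* x y zero    = sym (*-identityˡ 1#)
  pow-distribʳ-* x y (suc n) = trans (cong ((x * y) *_) (pow-distribʳ-* x y n))
    (solve 4 (λ x y a b → (x :* y) :* (a :* b) := (x :* a) :* (y :* b)) refl x y _ _)

  pow-1# : ∀ n → pow 1# n ≡ 1#
  pow-1# zero    = refl
  pow-1# (suc n) = trans (*-identityˡ _) (pow-1# n)

  pow-*-assoc : ∀ x m n → pow x (m *ℕ n) ≡ pow (pow x m) n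
  pow-*-assoc x zero    n = sym (pow-1# n)
  pow-*-assoc x (suc m) n = begin
    pow x (n +ℕ m *ℕ n)       ≡⟨ pow-distribˡ-+ x n (m *ℕ n) ⟩
    pow x n * pow x (m *ℕ n)  ≡⟨ cong (pow x n *_) (pow-*-assoc x m n) ⟩
    pow x n * pow (pow x m) n ≡⟨ sym (pow-distribʳ-* x (pow x m) n) ⟩
    pow (x * pow x m) n       ∎
    where open ≡-Reasoning

  pow-0# : ∀ n .{{_ : NonZero n}} → pow 0# n ≡ 0#
  pow-0# (suc n) = zeroˡ _

  pow-2^-0# : ∀ n → pow 0# (2 ^ n) ≡ 0#
  pow-2^-0# n = pow-0# (2 ^ n) {{ℕ.m^n≢0 2 n}}

  pow-2^-suc : ∀ x n → pow x (2 ^ suc n) ≡ pow x (2 ^ n) * pow x (2 ^ n)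
  pow-2^-suc x n = trans (cong (λ k → pow x (2 ^ n +ℕ k)) (ℕ.+-identityʳ (2 ^ n))) (pow-distribˡ-+ x (2 ^ n) (2 ^ n))

  frobenius : ∀ n x y → pow (x + y) (2 ^ n) ≡ pow x (2 ^ n) + pow y (2 ^ n)
  frobenius zero    x y = solve 2 (λ x y → (x :+ y) :* con true := x :* con true :+ y :* con true) refl x y
  frobenius (suc n) x y = begin
    pow (x + y) (2 ^ suc n)                   ≡⟨ pow-2^-suc (x + y) n ⟩
    pow (x + y) (2 ^ n) * pow (x + y) (2 ^ n) ≡⟨ cong₂ _*_ (frobenius n x y) (frobenius n x y) ⟩
    (xⁿ + yⁿ) * (xⁿ + yⁿ)                     ≡⟨ solve 2 (λ u v → (u :+ v) :* (u :+ v) := u :* u :+ v :* v) refl xⁿ yⁿ ⟩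
    xⁿ * xⁿ + yⁿ * yⁿ                         ≡⟨ sym (cong₂ _+_ (pow-2^-suc x n) (pow-2^-suc y n)) ⟩
    pow x (2 ^ suc n) + pow y (2 ^ suc n)     ∎
    where
    open ≡-Reasoning
    xⁿ yⁿ : Carrier
    xⁿ = pow x (2 ^ n)
    yⁿ = pow y (2 ^ n)

  traceSum-+ : ∀ n x y → traceSum n (x + y) ≡ traceSum n x + traceSum n y
  traceSum-+ zero    x y = sym (+-identityˡ 0#)
  traceSum-+ (suc n) x y = trans (cong₂ _+_ (traceSum-+ n x y) (frobenius n x y))
    (solve 4 (λ a b c d → (a :+ b) :+ (c :+ d) := (a :+ c) :+ (b :+ d)) refl _ _ _ _)

  traceSum-0# : ∀ n → traceSum n 0# ≡ 0#
  traceSum-0# zero    = refl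
  traceSum-0# (suc n) = trans (cong₂ _+_ (traceSum-0# n) (pow-2^-0# n)) (+-identityˡ 0#)

  traceSum-square : ∀ n x → traceSum n x * traceSum n x ≡ traceSum n (x * x)
  traceSum-square zero    x = zeroˡ 0#
  traceSum-square (suc n) x = begin
    (traceSum n x + xⁿ) * (traceSum n x + xⁿ) ≡⟨ solve 2 (λ u v → (u :+ v) :* (u :+ v) := u :* u :+ v :* v) refl _ _ ⟩
    traceSum n x * traceSum n x + xⁿ * xⁿ     ≡⟨ cong₂ _+_ (traceSum-square n x) (sym (pow-distribʳ-* x x (2 ^ n))) ⟩
    traceSum n (x * x) + pow (x * x) (2 ^ n)  ∎
    where
    open ≡-Reasoning
    xⁿ : Carrier
    xⁿ = pow x (2 ^ n)

  -- Tr(x²) and Tr(x) differ by the two end terms x and x^(2ⁿ) of the sum.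
  traceSum-of-square : ∀ n x → traceSum n (x * x) ≡ traceSum n x + x + pow x (2 ^ n)
  traceSum-of-square zero    x = solve 1 (λ x → con false := con false :+ x :+ x :* con true) refl x
  traceSum-of-square (suc n) x = begin
    traceSum n (x * x) + pow (x * x) (2 ^ n)
      ≡⟨ cong₂ _+_ (traceSum-of-square n x) (trans (pow-distribʳ-* x x (2 ^ n)) (sym (pow-2^-suc x n))) ⟩
    traceSum n x + x + pow x (2 ^ n) + pow x (2 ^ suc n)
      ≡⟨ solve 4 (λ t x a b → t :+ x :+ a :+ b := t :+ a :+ x :+ b) refl _ _ _ _ ⟩
    traceSum n x + pow x (2 ^ n) + x + pow x (2 ^ suc n) ∎
    where open ≡-Reasoning

  module _ (n : ℕ) {x : Carrier} (fixed : pow x (2 ^ n) ≡ x) where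

    traceSum-of-square-fixed : traceSum n (x * x) ≡ traceSum n x
    traceSum-of-square-fixed = begin
      traceSum n (x * x)               ≡⟨ traceSum-of-square n x ⟩
      traceSum n x + x + pow x (2 ^ n) ≡⟨ cong (traceSum n x + x +_) fixed ⟩
      traceSum n x + x + x             ≡⟨ +-assoc _ _ _ ⟩
      traceSum n x + (x + x)           ≡⟨ cong (traceSum n x +_) (x+x≡0 x) ⟩
      traceSum n x + 0#                ≡⟨ +-identityʳ _ ⟩
      traceSum n x                     ∎
      where open ≡-Reasoning

    traceSum-fixed∈𝔽₂ : traceSum n x ≡ 0# ⊎ traceSum n x ≡ 1#
    traceSum-fixed∈𝔽₂ = x*x≡x⇒x≡0⊎x≡1 (trans (traceSum-square n x) traceSum-of-square-fixed)

    traceSum-artinSchreier : traceSum n (x * x + x) ≡ 0#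
    traceSum-artinSchreier = trans (traceSum-+ n (x * x) x) (x≡y⇒x+y≡0 traceSum-of-square-fixed)

  traceSum-+ℕ : ∀ m n x → traceSum (m +ℕ n) x ≡ traceSum n x + traceSum m (pow x (2 ^ n))
  traceSum-+ℕ zero    n x = sym (+-identityʳ _)
  traceSum-+ℕ (suc m) n x = begin
    traceSum (m +ℕ n) x + pow x (2 ^ (m +ℕ n))
      ≡⟨ cong₂ _+_ (traceSum-+ℕ m n x) (trans (cong (pow x) 2^[m+n]) (pow-*-assoc x (2 ^ n) (2 ^ m))) ⟩
    traceSum n x + traceSum m (pow x (2 ^ n)) + pow (pow x (2 ^ n)) (2 ^ m)
      ≡⟨ +-assoc _ _ _ ⟩
    traceSum n x + (traceSum m (pow x (2 ^ n)) + pow (pow x (2 ^ n)) (2 ^ m)) ∎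
    where
    open ≡-Reasoning
    2^[m+n] : 2 ^ (m +ℕ n) ≡ 2 ^ n *ℕ 2 ^ m
    2^[m+n] = trans (ℕ.^-distribˡ-+-* 2 m n) (ℕ.*-comm (2 ^ m) (2 ^ n))

  -- Fermat: the map y ↦ a y permutes the nonzero elements, so their product P
  -- satisfies a^(order - 1) P = P.
  module Fermat where
    open FiniteSum *-isCommutativeMonoid using () renaming (∑ to ∏; ∑-cong to ∏-cong; ∑-distrib to ∏-distrib; ∑-reindex to ∏-reindex)

    χ≢0 : Carrier → ℕ
    χ≢0 y = χ (¬? (y ≟ 0#))

    nonzeroOr1 : Carrier → Carrier
    nonzeroOr1 y with y ≟ 0#
    ... | yes _ = 1#
    ... | no  _ = y

    nonzeroOr1-≢0 : ∀ y → nonzeroOr1 y ≢ 0#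
    nonzeroOr1-≢0 y with y ≟ 0#
    ... | yes _   = 1≢0
    ... | no  y≢0 = y≢0

    nonzeroOr1-* : ∀ a → a ≢ 0# → ∀ y → nonzeroOr1 (a * y) ≡ pow a (χ≢0 y) * nonzeroOr1 y
    nonzeroOr1-* a a≢0 y with y ≟ 0# | (a * y) ≟ 0#
    ... | yes _    | yes _    = sym (*-identityˡ 1#)
    ... | yes refl | no ay≢0  = ⊥-elim (ay≢0 (zeroʳ a))
    ... | no  y≢0  | yes ay≡0 = ⊥-elim (*-≢0 a≢0 y≢0 ay≡0)
    ... | no  _    | no  _    = cong (_* y) (sym (*-identityʳ a))

    ∏-nonzero : (xs : List Carrier) → ∏ xs nonzeroOr1 ≢ 0#
    ∏-nonzero []       = 1≢0
    ∏-nonzero (y ∷ xs) = *-≢0 (nonzeroOr1-≢0 y) (∏-nonzero xs)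

    ∏-pow : ∀ a (xs : List Carrier) (e : Carrier → ℕ) → ∏ xs (pow a ∘ e) ≡ pow a (∑ xs e)
    ∏-pow a []       e = refl
    ∏-pow a (y ∷ xs) e = trans (cong (pow a (e y) *_) (∏-pow a xs e)) (sym (pow-distribˡ-+ a (e y) _))

    order≡1+∑χ≢0 : order ≡ suc (∑𝔽 χ≢0)
    order≡1+∑χ≢0 = begin
      order                           ≡⟨ order≡∑𝔽1 ⟩
      ∑𝔽 (λ _ → 1)                    ≡⟨ ∑-cong elements (λ y _ → split y) ⟩
      ∑𝔽 (λ y → χ (y ≟ 0#) +ℕ χ≢0 y)  ≡⟨ ∑-distrib elements _ _ ⟩
      ∑𝔽 (λ y → χ (y ≟ 0#)) +ℕ ∑𝔽 χ≢0 ≡⟨ cong (_+ℕ ∑𝔽 χ≢0) (#-≟ 0#) ⟩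
      suc (∑𝔽 χ≢0)                    ∎
      where
      open ≡-Reasoning
      split : ∀ y → 1 ≡ χ (y ≟ 0#) +ℕ χ≢0 y
      split y with y ≟ 0#
      ... | yes _ = refl
      ... | no  _ = refl

    pow-order-1 : ∀ a → a ≢ 0# → pow a (∑𝔽 χ≢0) ≡ 1#
    pow-order-1 a a≢0 = *-cancelˡ (∏-nonzero elements) (trans (*-comm _ _) (begin
      pow a (∑𝔽 χ≢0) * P                              ≡⟨ cong (_* P) (sym (∏-pow a elements χ≢0)) ⟩
      ∏ elements (pow a ∘ χ≢0) * P                    ≡⟨ sym (∏-distrib elements _ nonzeroOr1) ⟩
      ∏ elements (λ y → pow a (χ≢0 y) * nonzeroOr1 y) ≡⟨ sym (∏-cong elements (λ y _ → nonzeroOr1-* a a≢0 y)) ⟩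
      ∏ elements (nonzeroOr1 ∘ (a *_))                ≡⟨ ∏-reindex elements-unique elements-complete (a *_) (inv a a≢0 *_)
                                                         (inv-*-cancelˡ a a≢0) (*-inv-cancelˡ a a≢0) nonzeroOr1 ⟩
      P                                             ≡⟨ sym (*-identityʳ P) ⟩
      P * 1#                                        ∎))
      where
      open ≡-Reasoning
      P : Carrier
      P = ∏ elements nonzeroOr1

    fermat : ∀ a → pow a order ≡ a
    fermat a with a ≟ 0#
    ... | yes refl = trans (cong (pow 0#) order≡1+∑χ≢0) (zeroˡ _)
    ... | no  a≢0  = trans (cong (pow a) order≡1+∑χ≢0) (trans (cong (a *_) (pow-order-1 a a≢0)) (*-identityʳ a))

  open Fermat public using (fermat)

  -- Polynomial functions, presented by Horner's scheme f x = x · g x + c.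
  data Degree≤ : ℕ → (Carrier → Carrier) → Set where
    const : ∀ {f} c → (∀ x → f x ≡ c) → Degree≤ 0 f
    horner : ∀ {d f} g c → Degree≤ d g → (∀ x → f x ≡ x * g x + c) → Degree≤ (suc d) f

  data Monic : ℕ → (Carrier → Carrier) → Set where
    one : ∀ {f} → (∀ x → f x ≡ 1#) → Monic 0 f
    horner : ∀ {d f} g c → Monic d g → (∀ x → f x ≡ x * g x + c) → Monic (suc d) f

  Monic-resp : ∀ {d f g} → Monic d f → (∀ x → f x ≡ g x) → Monic d g
  Monic-resp (one e)          f≗g = one (λ x → trans (sym (f≗g x)) (e x))
  Monic-resp (horner g c m e) f≗g = horner g c m (λ x → trans (sym (f≗g x)) (e x))

  Degree≤-const : ∀ d c → Degree≤ d (λ _ → c)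
  Degree≤-const zero    c = const c (λ _ → refl)
  Degree≤-const (suc d) c = horner (λ _ → 0#) c (Degree≤-const d 0#) (λ x → sym (trans (cong (_+ c) (zeroʳ x)) (+-identityˡ c)))

  Degree≤-id : Degree≤ 1 (λ x → x)
  Degree≤-id = horner (λ _ → 1#) 0# (const 1# (λ _ → refl)) (λ x → sym (trans (+-identityʳ _) (*-identityʳ x)))

  Degree≤-mono : ∀ {d e f} → d ≤ e → Degree≤ d f → Degree≤ e f
  Degree≤-mono {e = e} z≤n (const c f≗c) = go (Degree≤-const e c)
    where
    go : ∀ {e} → Degree≤ e (λ _ → c) → Degree≤ e _
    go (const c′ e′)      = const c′ (λ x → trans (f≗c x) (e′ x))
    go (horner g c′ m e′) = horner g c′ m (λ x → trans (f≗c x) (e′ x))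
  Degree≤-mono (s≤s d≤e) (horner g c p e) = horner g c (Degree≤-mono d≤e p) e

  Monic⇒Degree≤ : ∀ {d f} → Monic d f → Degree≤ d f
  Monic⇒Degree≤ (one e)          = const 1# e
  Monic⇒Degree≤ (horner g c m e) = horner g c (Monic⇒Degree≤ m) e

  Monic-+ : ∀ {d f g} → Monic (suc d) f → Degree≤ d g → Monic (suc d) (λ x → f x + g x)
  Monic-+ (horner f′ c m ef) (const c′ eg) =
    horner f′ (c + c′) m (λ x → trans (cong₂ _+_ (ef x) (eg x)) (+-assoc _ _ _))
  Monic-+ (horner f′ c m ef) (horner g′ c′ p eg) = horner (λ x → f′ x + g′ x) (c + c′) (Monic-+ m p)
    (λ x → trans (cong₂ _+_ (ef x) (eg x))
      (solve 5 (λ x a c b c′ → (x :* a :+ c) :+ (x :* b :+ c′) := x :* (a :+ b) :+ (c :+ c′)) refl x _ _ _ _))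

  Monic-pow : ∀ n → Monic n (λ x → pow x n)
  Monic-pow zero    = one (λ _ → refl)
  Monic-pow (suc n) = horner (λ x → pow x n) 0# (Monic-pow n) (λ x → sym (+-identityʳ _))

  Monic-divide : ∀ {d f} → Monic (suc d) f → (r : Carrier) →
    Σ (Carrier → Carrier) (λ g → Monic d g × (∀ x → f x ≡ (x + r) * g x + f r))
  Monic-divide {zero} {f} (horner f′ c (one e) ef) r = (λ _ → 1#) , one (λ _ → refl) , λ x → begin
    f x                           ≡⟨ ef x ⟩
    x * f′ x + c                  ≡⟨ cong (λ z → x * z + c) (e x) ⟩
    x * 1# + c                    ≡⟨ solve 3 (λ x r c → x :* con true :+ c := (x :+ r) :* con true :+ (r :* con true :+ c)) refl x r c ⟩
    (x + r) * 1# + (r * 1# + c)   ≡⟨ cong (λ z → (x + r) * 1# + (r * z + c)) (sym (e r)) ⟩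
    (x + r) * 1# + (r * f′ r + c) ≡⟨ cong ((x + r) * 1# +_) (sym (ef r)) ⟩
    (x + r) * 1# + f r            ∎
    where open ≡-Reasoning
  Monic-divide {suc d} {f} (horner f′ c m ef) r with Monic-divide m r
  ... | g′ , m′ , eg′ = (λ x → x * g′ x + f′ r) , horner g′ (f′ r) m′ (λ _ → refl) , λ x → begin
    f x                                          ≡⟨ ef x ⟩
    x * f′ x + c                                 ≡⟨ cong (λ z → x * z + c) (eg′ x) ⟩
    x * ((x + r) * g′ x + f′ r) + c              ≡⟨ solve 5 (λ x r g a c → x :* ((x :+ r) :* g :+ a) :+ c := (x :+ r) :* (x :* g :+ a) :+ (r :* a :+ c)) refl x r (g′ x) (f′ r) c ⟩
    (x + r) * (x * g′ x + f′ r) + (r * f′ r + c) ≡⟨ cong ((x + r) * (x * g′ x + f′ r) +_) (sym (ef r)) ⟩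
    (x + r) * (x * g′ x + f′ r) + f r            ∎
    where open ≡-Reasoning

  Monic-roots : ∀ {d f} → Monic d f → {xs : List Carrier} → Unique xs → ∑ xs (λ x → χ (f x ≟ 0#)) ≤ d
  Monic-roots m                  {[]}     _ = z≤n
  Monic-roots {d} {f} m          {x ∷ xs} (x∉ ∷ u) with f x ≟ 0#
  ... | no _ = Monic-roots m u
  Monic-roots (one e)            {x ∷ xs} (x∉ ∷ u) | yes fx≡0 = ⊥-elim (1≢0 (trans (sym (e x)) fx≡0))
  Monic-roots {suc d} {f} m      {x ∷ xs} (x∉ ∷ u) | yes fx≡0 with Monic-divide m x
  ... | g , mg , eg = s≤s (ℕ.≤-trans (∑-mono-≤ xs (λ y y∈ → χ-mono (f y ≟ 0#) (g y ≟ 0#) (root-of-quotient y y∈))) (Monic-roots mg u))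
    where
    root-of-quotient : ∀ y → y ∈ xs → f y ≡ 0# → g y ≡ 0#
    root-of-quotient y y∈ fy≡0
      with x*y≡0⇒x≡0⊎y≡0 (trans (sym (trans (cong ((y + x) * g y +_) fx≡0) (+-identityʳ _))) (trans (sym (eg y)) fy≡0))
    ... | inj₁ y+x≡0 = ⊥-elim (All.lookup x∉ y∈ (sym (x+y≡0⇒x≡y y+x≡0)))
    ... | inj₂ gy≡0  = gy≡0

  Monic-fibre : ∀ {d f} .{{_ : NonZero d}} → Monic d f → (c : Carrier) → ∑𝔽 (λ x → χ (f x ≟ c)) ≤ d
  Monic-fibre {zero} {{d≢0}} _ _ = ⊥-elim (≢-nonZero⁻¹ 0 {{d≢0}} refl)
  Monic-fibre {suc d} {f} m c = ℕ.≤-trans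
    (ℕ.≤-reflexive (∑-cong elements (λ x _ → χ-cong (f x ≟ c) ((f x + c) ≟ 0#) x≡y⇒x+y≡0 x+y≡0⇒x≡y)))
    (Monic-roots (Monic-+ m (Degree≤-const d c)) elements-unique)

  2^n≡suc : ∀ n → 2 ^ n ≡ suc (pred (2 ^ n))
  2^n≡suc n = sym (ℕ.suc-pred (2 ^ n) {{ℕ.m^n≢0 2 n}})

  Monic-traceSum : ∀ n → Monic (2 ^ n) (traceSum (suc n))
  Degree≤-traceSum : ∀ n → Degree≤ (pred (2 ^ n)) (traceSum n)

  Monic-traceSum n = subst (λ d → Monic d (traceSum (suc n))) (sym (2^n≡suc n))
    (Monic-resp (Monic-+ (Monic-pow (suc (pred (2 ^ n)))) (Degree≤-traceSum n))
      (λ x → trans (+-comm _ _) (cong (λ k → traceSum n x + pow x k) (sym (2^n≡suc n)))))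

  Degree≤-traceSum zero    = const 0# (λ _ → refl)
  Degree≤-traceSum (suc n) = Degree≤-mono 2^n≤pred2^[n+1] (Monic⇒Degree≤ (Monic-traceSum n))
    where
    2^n≤pred2^[n+1] : 2 ^ n ≤ pred (2 ^ suc n)
    2^n≤pred2^[n+1] rewrite 2^n≡suc n | ℕ.+-identityʳ (pred (2 ^ n)) = ℕ.m≤n+m _ _

-- The field with Q = q² elements and the sets Rᵢ

module QuadraticExtension (F : FiniteField) (h′ : ℕ)
  (char2 : FiniteField._+_ F (FiniteField.1# F) (FiniteField.1# F) ≡ FiniteField.0# F)
  (order≡q² : FiniteField.order F ≡ 2 ^ suc h′ *ℕ 2 ^ suc h′) where
  open import Data.Empty using (⊥; ⊥-elim)
  open import Data.Nat using (pred; _≤_) renaming (_+_ to _+ℕ_)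
  open import Data.Sum using (_⊎_; inj₁; inj₂)
  open import Function using (_∘_)
  open import Relation.Nullary using (¬_; Dec; yes; no; ¬?; _×-dec_)
  open import Relation.Binary.PropositionalEquality
  open import Algebra.Structures using (IsCommutativeRing)

  open FiniteField F
  open IsCommutativeRing isCommutativeRing using (+-comm)
  open CharacteristicTwo F char2
  open Counting F
  open Conic F (suc h′)

  -- q = 2k, Q = q² = 2 · 2ᵉ, and TrQ = traceSum (suc e)
  k e : ℕ
  k = 2 ^ h′
  e = pred (2 *ℕ suc h′)

  order≡2^[1+e] : order ≡ 2 ^ suc e
  order≡2^[1+e] = trans order≡q² (trans (sym (ℕ.^-distribˡ-+-* 2 (suc h′) (suc h′)))
    (cong (λ m → 2 ^ (suc h′ +ℕ m)) (sym (ℕ.+-identityʳ (suc h′)))))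

  order≡2ᵉ+2ᵉ : order ≡ 2 ^ e +ℕ 2 ^ e
  order≡2ᵉ+2ᵉ = trans order≡2^[1+e] (cong (2 ^ e +ℕ_) (ℕ.+-identityʳ (2 ^ e)))

  pow-Q : ∀ x → pow x (2 ^ suc e) ≡ x
  pow-Q x = trans (cong (pow x) (sym order≡2^[1+e])) (fermat x)

  pow-q-q : ∀ x → pow (pow x q) q ≡ x
  pow-q-q x = trans (sym (pow-*-assoc x q q)) (trans (cong (pow x) (sym order≡q²)) (fermat x))

  TrQ∈𝔽₂ : ∀ x → TrQ x ≡ 0# ⊎ TrQ x ≡ 1#
  TrQ∈𝔽₂ x = traceSum-fixed∈𝔽₂ (suc e) (pow-Q x)

  TrQ-artinSchreier : ∀ x → TrQ (x * x + x) ≡ 0#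
  TrQ-artinSchreier x = traceSum-artinSchreier (suc e) (pow-Q x)

  TrQ-+ : ∀ x y → TrQ (x + y) ≡ TrQ x + TrQ y
  TrQ-+ = traceSum-+ (suc e)

  Trq∈𝔽₂ : ∀ {x} → inFq x → Trq x ≡ 0# ⊎ Trq x ≡ 1#
  Trq∈𝔽₂ x∈Fq = traceSum-fixed∈𝔽₂ (suc h′) x∈Fq

  -- TrQ x = Trq x + Trq (x^q), and x^q = x on 𝔽_q.
  inFq⇒TrQ≡0 : ∀ {x} → inFq x → TrQ x ≡ 0#
  inFq⇒TrQ≡0 {x} x∈Fq = begin
    TrQ x                               ≡⟨ cong (λ m → traceSum (suc h′ +ℕ m) x) (ℕ.+-identityʳ (suc h′)) ⟩
    traceSum (suc h′ +ℕ suc h′) x       ≡⟨ traceSum-+ℕ (suc h′) (suc h′) x ⟩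
    Trq x + traceSum (suc h′) (pow x q) ≡⟨ cong (λ y → Trq x + Trq y) x∈Fq ⟩
    Trq x + Trq x                       ≡⟨ x+x≡0 (Trq x) ⟩
    0#                                  ∎
    where open ≡-Reasoning

  T₀? : ∀ x → Dec (TrQ x ≡ 0#)
  T₁? : ∀ x → Dec (TrQ x ≡ 1#)
  T₀? x = TrQ x ≟ 0#
  T₁? x = TrQ x ≟ 1#

  |T₀|≡2ᵉ×|T₁|≡2ᵉ : #[ T₀? ] ≡ 2 ^ e × #[ T₁? ] ≡ 2 ^ e
  |T₀|≡2ᵉ×|T₁|≡2ᵉ = halves (fibre 0#) (fibre 1#) (trans T₀+T₁ order≡2ᵉ+2ᵉ)
    where
    fibre : ∀ c → #[ (λ x → TrQ x ≟ c) ] ≤ 2 ^ e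
    fibre = Monic-fibre {{ℕ.m^n≢0 2 e}} (Monic-traceSum e)
    ¬T₀⇒T₁ : ∀ {x} → ¬ TrQ x ≡ 0# → TrQ x ≡ 1#
    ¬T₀⇒T₁ {x} ¬t₀ with TrQ∈𝔽₂ x
    ... | inj₁ t₀ = ⊥-elim (¬t₀ t₀)
    ... | inj₂ t₁ = t₁
    T₀+T₁ : #[ T₀? ] +ℕ #[ T₁? ] ≡ order
    T₀+T₁ = trans (cong (#[ T₀? ] +ℕ_) (#-cong T₁? (¬? ∘ T₀?) (λ t₁ t₀ → 0≢1 (trans (sym t₀) t₁)) ¬T₀⇒T₁))
                  (#-complement T₀?)

  inFq? : ∀ x → Dec (inFq x)
  inFq? x = pow x q ≟ x

  q≡suc : q ≡ suc (pred q)
  q≡suc = 2^n≡suc (suc h′)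

  -- 𝔽_q is the zero set of x ↦ x^q + x, whose fibres lie over 𝔽_q.
  N : Carrier → Carrier
  N x = pow x q + x

  Monic-N : Monic q N
  Monic-N = subst (λ d → Monic d N) (sym q≡suc)
    (Monic-resp (Monic-+ (Monic-pow (suc (pred q))) (Degree≤-mono 1≤pred-q Degree≤-id))
      (λ x → cong (λ m → pow x m + x) (sym q≡suc)))
    where
    1≤pred-q : 1 ≤ pred q
    1≤pred-q = ℕ.pred-mono-≤ (ℕ.*-monoʳ-≤ 2 (ℕ.m^n>0 2 h′))

  N-inFq : ∀ x → inFq (N x)
  N-inFq x = trans (frobenius (suc h′) (pow x q) x) (trans (cong (_+ pow x q) (pow-q-q x)) (+-comm _ _))

  fibre-N : ∀ c → #[ (λ x → N x ≟ c) ] ≤ q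
  fibre-N = Monic-fibre {{ℕ.m^n≢0 2 (suc h′)}} Monic-N

  fibre-N-inFq : ∀ c → #[ (λ x → N x ≟ c) ] ≤ χ (inFq? c) *ℕ q
  fibre-N-inFq c with inFq? c
  ... | yes _   = ℕ.≤-trans (fibre-N c) (ℕ.≤-reflexive (sym (ℕ.+-identityʳ q)))
  ... | no  c∉Fq = ℕ.≤-reflexive (trans (∑-cong elements (λ x _ → χ-cong (N x ≟ c) (no (λ ())) (λ { refl → c∉Fq (N-inFq x) }) λ ()))
                                        (∑-ε elements))

  |Fq|≡q : #[ inFq? ] ≡ q
  |Fq|≡q = ℕ.≤-antisym |Fq|≤q q≤|Fq|
    where
    |Fq|≤q : #[ inFq? ] ≤ q
    |Fq|≤q = ℕ.≤-trans (ℕ.≤-reflexive (#-cong inFq? (λ x → N x ≟ 0#) x≡y⇒x+y≡0 x+y≡0⇒x≡y)) (fibre-N 0#)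
    q≤|Fq| : q ≤ #[ inFq? ]
    q≤|Fq| = ℕ.*-cancelʳ-≤ q _ q {{ℕ.m^n≢0 2 (suc h′)}} (begin
      q *ℕ q                          ≡⟨ sym order≡q² ⟩
      order                           ≡⟨ sym (∑𝔽-fibres N) ⟩
      ∑𝔽 (λ c → #[ (λ x → N x ≟ c) ]) ≤⟨ ∑-mono-≤ elements (λ c _ → fibre-N-inFq c) ⟩
      ∑𝔽 (λ c → χ (inFq? c) *ℕ q)     ≡⟨ ∑-cong elements (λ c _ → ℕ.*-comm _ q) ⟩
      ∑𝔽 (λ c → q *ℕ χ (inFq? c))     ≡⟨ ∑-*-distribˡ elements q _ ⟩
      q *ℕ #[ inFq? ]                 ≡⟨ ℕ.*-comm q _ ⟩
      #[ inFq? ] *ℕ q                  ∎)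
      where open ℕ.≤-Reasoning

  S₀? : ∀ x → Dec (inFq x × Trq x ≡ 0#)
  S₁? : ∀ x → Dec (inFq x × ¬ Trq x ≡ 0#)
  S₀? x = inFq? x ×-dec (Trq x ≟ 0#)
  S₁? x = inFq? x ×-dec ¬? (Trq x ≟ 0#)

  |S₀|≡k×|S₁|≡k : #[ S₀? ] ≡ k × #[ S₁? ] ≡ k
  |S₀|≡k×|S₁|≡k = halves
    (ℕ.≤-trans (#-mono S₀? (λ x → Trq x ≟ 0#) proj₂) (fibre 0#))
    (ℕ.≤-trans (#-mono S₁? (λ x → Trq x ≟ 1#) S₁⇒Trq≡1) (fibre 1#))
    (trans (#-split inFq? (λ x → Trq x ≟ 0#)) (trans |Fq|≡q (cong (k +ℕ_) (ℕ.+-identityʳ k))))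
    where
    fibre : ∀ c → #[ (λ x → Trq x ≟ c) ] ≤ k
    fibre = Monic-fibre {{ℕ.m^n≢0 2 h′}} (Monic-traceSum h′)
    S₁⇒Trq≡1 : ∀ {x} → inFq x × ¬ Trq x ≡ 0# → Trq x ≡ 1#
    S₁⇒Trq≡1 (x∈Fq , ¬t₀) with Trq∈𝔽₂ x∈Fq
    ... | inj₁ t₀ = ⊥-elim (¬t₀ t₀)
    ... | inj₂ t₁ = t₁

  inFq-0# : inFq 0#
  inFq-0# = pow-2^-0# (suc h′)

  TrQ-0# : TrQ 0# ≡ 0#
  TrQ-0# = traceSum-0# (suc e)

  1+|R₁|≡k : 1 +ℕ #[ R? ι₁ ] ≡ k
  1+|R₁|≡k = trans (cong₂ _+ℕ_ zero-part nonzero-part) (trans (#-split S₀? (_≟ 0#)) (proj₁ |S₀|≡k×|S₁|≡k))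
    where
    zero-part : 1 ≡ #[ (λ x → S₀? x ×-dec (x ≟ 0#)) ]
    zero-part = trans (sym (#-≟ 0#)) (#-cong (_≟ 0#) _ (λ { refl → (inFq-0# , traceSum-0# (suc h′)) , refl }) proj₂)
    nonzero-part : #[ R? ι₁ ] ≡ #[ (λ x → S₀? x ×-dec ¬? (x ≟ 0#)) ]
    nonzero-part = #-cong (R? ι₁) _ (λ (x∈Fq , t₀ , x≢0) → (x∈Fq , t₀) , x≢0) (λ ((x∈Fq , t₀) , x≢0) → x∈Fq , t₀ , x≢0)

  |R₂|≡k : #[ R? ι₂ ] ≡ k
  |R₂|≡k = trans (#-cong (R? ι₂) S₁? (λ r → r) (λ r → r)) (proj₂ |S₀|≡k×|S₁|≡k)

  q+|R₃|≡2ᵉ : q +ℕ #[ R? ι₃ ] ≡ 2 ^ e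
  q+|R₃|≡2ᵉ = trans (cong₂ _+ℕ_ Fq-part rest) (trans (#-split T₀? inFq?) (proj₁ |T₀|≡2ᵉ×|T₁|≡2ᵉ))
    where
    Fq-part : q ≡ #[ (λ x → T₀? x ×-dec inFq? x) ]
    Fq-part = trans (sym |Fq|≡q) (#-cong inFq? _ (λ x∈Fq → inFq⇒TrQ≡0 x∈Fq , x∈Fq) proj₂)
    rest : #[ R? ι₃ ] ≡ #[ (λ x → T₀? x ×-dec ¬? (inFq? x)) ]
    rest = #-cong (R? ι₃) _ (λ r → r) (λ r → r)

  |R₄|≡1 : #[ R? ι₄ ] ≡ 1
  |R₄|≡1 = #-≟ 0#

  |R₅|≡2ᵉ : #[ R? ι₅ ] ≡ 2 ^ e
  |R₅|≡2ᵉ = proj₂ |T₀|≡2ᵉ×|T₁|≡2ᵉ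

  τ : Fin 5 → Carrier
  τ i = fromBool (isι₅ i)

  R⇒TrQ≡τ : ∀ i {a} → R i a → TrQ a ≡ τ i
  R⇒TrQ≡τ ι₁ (a∈Fq , _)   = inFq⇒TrQ≡0 a∈Fq
  R⇒TrQ≡τ ι₂ (a∈Fq , _)   = inFq⇒TrQ≡0 a∈Fq
  R⇒TrQ≡τ ι₃ (t₀ , _)     = t₀
  R⇒TrQ≡τ ι₄ refl         = TrQ-0#
  R⇒TrQ≡τ ι₅ t₁           = t₁

  T₀∩T₁≡∅ : ∀ {x} → TrQ x ≡ 0# → TrQ x ≡ 1# → ⊥
  T₀∩T₁≡∅ t₀ t₁ = 0≢1 (trans (sym t₀) t₁)

  R-disjoint : ∀ i j {a} → R i a → R j a → i ≡ j
  R-disjoint ι₁ ι₁ _ _ = refl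
  R-disjoint ι₂ ι₂ _ _ = refl
  R-disjoint ι₃ ι₃ _ _ = refl
  R-disjoint ι₄ ι₄ _ _ = refl
  R-disjoint ι₅ ι₅ _ _ = refl
  R-disjoint ι₁ ι₂ (_ , t₀ , _)  (_ , ¬t₀)     = ⊥-elim (¬t₀ t₀)
  R-disjoint ι₂ ι₁ (_ , ¬t₀)     (_ , t₀ , _)  = ⊥-elim (¬t₀ t₀)
  R-disjoint ι₁ ι₃ (a∈Fq , _)    (_ , a∉Fq)    = ⊥-elim (a∉Fq a∈Fq)
  R-disjoint ι₃ ι₁ (_ , a∉Fq)    (a∈Fq , _)    = ⊥-elim (a∉Fq a∈Fq)
  R-disjoint ι₁ ι₄ (_ , _ , a≢0) a≡0           = ⊥-elim (a≢0 a≡0)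
  R-disjoint ι₄ ι₁ a≡0           (_ , _ , a≢0) = ⊥-elim (a≢0 a≡0)
  R-disjoint ι₂ ι₃ (a∈Fq , _)    (_ , a∉Fq)    = ⊥-elim (a∉Fq a∈Fq)
  R-disjoint ι₃ ι₂ (_ , a∉Fq)    (a∈Fq , _)    = ⊥-elim (a∉Fq a∈Fq)
  R-disjoint ι₂ ι₄ (_ , ¬t₀)     refl          = ⊥-elim (¬t₀ (traceSum-0# (suc h′)))
  R-disjoint ι₄ ι₂ refl          (_ , ¬t₀)     = ⊥-elim (¬t₀ (traceSum-0# (suc h′)))
  R-disjoint ι₃ ι₄ (_ , a∉Fq)    refl          = ⊥-elim (a∉Fq inFq-0#)
  R-disjoint ι₄ ι₃ refl          (_ , a∉Fq)    = ⊥-elim (a∉Fq inFq-0#)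
  R-disjoint ι₁ ι₅ r             t₁            = ⊥-elim (T₀∩T₁≡∅ (R⇒TrQ≡τ ι₁ r) t₁)
  R-disjoint ι₅ ι₁ t₁            r             = ⊥-elim (T₀∩T₁≡∅ (R⇒TrQ≡τ ι₁ r) t₁)
  R-disjoint ι₂ ι₅ r             t₁            = ⊥-elim (T₀∩T₁≡∅ (R⇒TrQ≡τ ι₂ r) t₁)
  R-disjoint ι₅ ι₂ t₁            r             = ⊥-elim (T₀∩T₁≡∅ (R⇒TrQ≡τ ι₂ r) t₁)
  R-disjoint ι₃ ι₅ r             t₁            = ⊥-elim (T₀∩T₁≡∅ (R⇒TrQ≡τ ι₃ r) t₁)
  R-disjoint ι₅ ι₃ t₁            r             = ⊥-elim (T₀∩T₁≡∅ (R⇒TrQ≡τ ι₃ r) t₁)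
  R-disjoint ι₄ ι₅ r             t₁            = ⊥-elim (T₀∩T₁≡∅ (R⇒TrQ≡τ ι₄ r) t₁)
  R-disjoint ι₅ ι₄ t₁            r             = ⊥-elim (T₀∩T₁≡∅ (R⇒TrQ≡τ ι₄ r) t₁)

-- Counting in normal coordinates

module NormalForm (F : FiniteField) (h′ : ℕ)
  (char2 : FiniteField._+_ F (FiniteField.1# F) (FiniteField.1# F) ≡ FiniteField.0# F)
  (order≡q² : FiniteField.order F ≡ 2 ^ suc h′ *ℕ 2 ^ suc h′) where
  open import Data.Empty using (⊥-elim)
  open import Data.List.Membership.Propositional using (_∈_)
  open import Data.List.Membership.Propositional.Properties using (∈-cartesianProduct⁺)
  open import Data.List.Relation.Unary.Unique.Propositional using (Unique)
  import Data.List.Relation.Unary.Unique.Propositional.Properties as Unique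
  open import Data.Nat using (_≤_) renaming (_+_ to _+ℕ_)
  open import Data.Product.Properties using (≡-dec)
  open import Function using (_∘_)
  open import Relation.Nullary using (Dec; yes; no; ¬?; _×-dec_)
  open import Relation.Binary.Definitions using (DecidableEquality)
  open import Relation.Binary.PropositionalEquality
  open import Algebra.Structures using (IsCommutativeRing)

  open FiniteField F
  open IsCommutativeRing isCommutativeRing using (+-identityʳ; *-identityʳ; zeroˡ)
  open CharacteristicTwo F char2
  open Counting F
  open Conic F (suc h′)
  open QuadraticExtension F h′ char2 order≡q²

  φ : Carrier → Carrier
  φ t = t * t + t

  φ-0# : φ 0# ≡ 0#
  φ-0# = solve 0 (con false :* con false :+ con false := con false) refl

  -- the point (t, v) stands for the line n with (t, v) = Ψ n for a coordinate change Ψ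
  -- taking ℓ, m to (0, 0), (0, 1), in which ρ̂(ℓ, n) = t v and ρ̂(n, m) = t v + t² + t
  Normal : Fin 5 → Fin 5 → Carrier → Carrier → Set
  Normal i j t v = (t , v) ≢ (0# , 0#) × (t , v) ≢ (0# , 1#) × R i (t * v) × R j (t * v + φ t)

  _≟ᴸ_ : DecidableEquality Line
  _≟ᴸ_ = ≡-dec _≟_ _≟_

  Normal? : ∀ i j t v → Dec (Normal i j t v)
  Normal? i j t v = ¬? ((t , v) ≟ᴸ (0# , 0#)) ×-dec ¬? ((t , v) ≟ᴸ (0# , 1#)) ×-dec R? i (t * v) ×-dec R? j (t * v + φ t)

  normalCount : Fin 5 → Fin 5 → ℕ
  normalCount i j = ∑𝔽 (λ t → #[ Normal? i j t ])

  overlapCount : Fin 5 → Fin 5 → Carrier → ℕ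
  overlapCount i j c = #[ (λ α → R? i α ×-dec R? j (α + c)) ]

  #R : Fin 5 → ℕ
  #R i = #[ R? i ]

  normalRow-≢0 : ∀ i j {t} → t ≢ 0# → #[ Normal? i j t ] ≡ overlapCount i j (φ t)
  normalRow-≢0 i j {t} t≢0 = trans (#-cong (Normal? i j t) (λ v → R? i (t * v) ×-dec R? j (t * v + φ t)) (proj₂ ∘ proj₂)
      (λ r → (λ e → t≢0 (cong proj₁ e)) , (λ e → t≢0 (cong proj₁ e)) , r))
    (∑𝔽-reindex (t *_) (inv t t≢0 *_) (inv-*-cancelˡ t t≢0) (*-inv-cancelˡ t t≢0) _)

  v∉01? : ∀ v → Dec (v ≢ 0# × v ≢ 1#)
  v∉01? v = ¬? (v ≟ 0#) ×-dec ¬? (v ≟ 1#)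

  W : ℕ
  W = #[ v∉01? ]

  W+2≡order : W +ℕ 2 ≡ order
  W+2≡order = begin
    W +ℕ 2                                                ≡⟨ cong (W +ℕ_) (sym (cong₂ _+ℕ_ (#-≟ 0#) (#-≟ 1#))) ⟩
    W +ℕ (#[ _≟ 0# ] +ℕ #[ _≟ 1# ])                       ≡⟨ cong (W +ℕ_) (sym (∑-distrib elements _ _)) ⟩
    W +ℕ ∑𝔽 (λ v → χ (v ≟ 0#) +ℕ χ (v ≟ 1#))              ≡⟨ sym (∑-distrib elements _ _) ⟩
    ∑𝔽 (λ v → χ (v∉01? v) +ℕ (χ (v ≟ 0#) +ℕ χ (v ≟ 1#))) ≡⟨ ∑-cong elements (λ v _ → partition v) ⟩
    ∑𝔽 (λ _ → 1)                                          ≡⟨ sym order≡∑𝔽1 ⟩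
    order                                                 ∎
    where
    open ≡-Reasoning
    partition : ∀ v → χ (v∉01? v) +ℕ (χ (v ≟ 0#) +ℕ χ (v ≟ 1#)) ≡ 1
    partition v with v ≟ 0# | v ≟ 1#
    ... | yes refl | yes 0≡1 = ⊥-elim (0≢1 0≡1)
    ... | yes _    | no  _   = refl
    ... | no  _    | yes _   = refl
    ... | no  _    | no  _   = refl

  normalRow-0# : ∀ i j → #[ Normal? i j 0# ] ≡ χ (R? i 0#) *ℕ χ (R? j 0#) *ℕ W
  normalRow-0# i j = begin
    #[ Normal? i j 0# ]                                         ≡⟨ #-cong (Normal? i j 0#) R₀×v∉01? to from ⟩
    #[ R₀×v∉01? ]                                               ≡⟨ ∑-cong elements (λ v _ → χ-× (R? i 0# ×-dec R? j 0#) (v∉01? v)) ⟩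
    ∑𝔽 (λ v → χ (R? i 0# ×-dec R? j 0#) *ℕ χ (v∉01? v))         ≡⟨ ∑-*-distribˡ elements (χ (R? i 0# ×-dec R? j 0#)) _ ⟩
    χ (R? i 0# ×-dec R? j 0#) *ℕ W                              ≡⟨ cong (_*ℕ W) (χ-× (R? i 0#) (R? j 0#)) ⟩
    χ (R? i 0#) *ℕ χ (R? j 0#) *ℕ W                             ∎
    where
    open ≡-Reasoning
    R₀×v∉01? : ∀ v → Dec ((R i 0# × R j 0#) × v ≢ 0# × v ≢ 1#)
    R₀×v∉01? v = (R? i 0# ×-dec R? j 0#) ×-dec v∉01? v
    0·v≡0 : ∀ v → 0# * v ≡ 0#
    0·v≡0 = zeroˡ
    0·v+φ0≡0 : ∀ v → 0# * v + φ 0# ≡ 0#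
    0·v+φ0≡0 v = solve 1 (λ v → con false :* v :+ (con false :* con false :+ con false) := con false) refl v
    to : ∀ {v} → Normal i j 0# v → (R i 0# × R j 0#) × v ≢ 0# × v ≢ 1#
    to {v} (≢00 , ≢01 , r , s) =
      (subst (R i) (0·v≡0 v) r , subst (R j) (0·v+φ0≡0 v) s) , (λ v≡0 → ≢00 (cong (0# ,_) v≡0)) , (λ v≡1 → ≢01 (cong (0# ,_) v≡1))
    from : ∀ {v} → (R i 0# × R j 0#) × v ≢ 0# × v ≢ 1# → Normal i j 0# v
    from {v} ((r , s) , v≢0 , v≢1) =
      (λ e → v≢0 (cong proj₂ e)) , (λ e → v≢1 (cong proj₂ e)) , subst (R i) (sym (0·v≡0 v)) r , subst (R j) (sym (0·v+φ0≡0 v)) s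

  Monic-φ : Monic 2 φ
  Monic-φ = Monic-resp (Monic-+ (Monic-pow 2) Degree≤-id) (λ x → cong (λ y → x * y + x) (*-identityʳ x))

  φ-fibre : ∀ c → #[ (λ t → φ t ≟ c) ] ≡ 2 *ℕ χ (T₀? c)
  φ-fibre c = ∑-≤-≡⇒≡ elements (λ c _ → φ-fibre≤ c) sums c (elements-complete c)
    where
    φ-fibre≤ : ∀ c → #[ (λ t → φ t ≟ c) ] ≤ 2 *ℕ χ (T₀? c)
    φ-fibre≤ c with T₀? c
    ... | yes _   = Monic-fibre Monic-φ c
    ... | no  ¬t₀ = ℕ.≤-reflexive (trans (#-cong (λ t → φ t ≟ c) (λ _ → no (λ ())) (λ { refl → ¬t₀ (TrQ-artinSchreier _) }) λ ())
                                         (∑-ε elements))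
    sums : ∑𝔽 (λ c → #[ (λ t → φ t ≟ c) ]) ≡ ∑𝔽 (λ c → 2 *ℕ χ (T₀? c))
    sums = begin
      ∑𝔽 (λ c → #[ (λ t → φ t ≟ c) ]) ≡⟨ ∑𝔽-fibres φ ⟩
      order                           ≡⟨ order≡2^[1+e] ⟩
      2 *ℕ 2 ^ e                      ≡⟨ cong (2 *ℕ_) (sym (proj₁ |T₀|≡2ᵉ×|T₁|≡2ᵉ)) ⟩
      2 *ℕ #[ T₀? ]                   ≡⟨ sym (∑-*-distribˡ elements 2 _) ⟩
      ∑𝔽 (λ c → 2 *ℕ χ (T₀? c))       ∎
      where open ≡-Reasoning

  δ : Fin 5 → Fin 5 → ℕ
  δ i j = χ (τ i ≟ τ j)

  -- Substituting c = d + α, the trace condition becomes TrQ d = TrQ α, i.e. τ j = τ i.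
  ∑-T₀-translate : ∀ i j {α} → R i α → ∑𝔽 (λ c → χ (T₀? c) *ℕ χ (R? j (α + c))) ≡ δ i j *ℕ #R j
  ∑-T₀-translate i j {α} rα = begin
    ∑𝔽 (λ c → χ (T₀? c) *ℕ χ (R? j (α + c)))             ≡⟨ sym (∑𝔽-reindex (_+ α) (_+ α) +α+α (+α+α) _) ⟩
    ∑𝔽 (λ d → χ (T₀? (d + α)) *ℕ χ (R? j (α + (d + α)))) ≡⟨ ∑-cong elements (λ d _ → pointwise d) ⟩
    ∑𝔽 (λ d → δ i j *ℕ χ (R? j d))                       ≡⟨ ∑-*-distribˡ elements (δ i j) _ ⟩
    δ i j *ℕ #R j                                        ∎
    where
    open ≡-Reasoning
    +α+α : ∀ d → d + α + α ≡ d
    +α+α d = solve 2 (λ d a → d :+ a :+ a := d) refl d α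
    same-trace : ∀ {d} → R j d → TrQ (d + α) ≡ 0# → τ i ≡ τ j
    same-trace rd t₀ = sym (x+y≡0⇒x≡y (trans (sym (cong₂ _+_ (R⇒TrQ≡τ j rd) (R⇒TrQ≡τ i rα))) (trans (sym (TrQ-+ _ α)) t₀)))
    trace-vanishes : ∀ {d} → R j d → τ i ≡ τ j → TrQ (d + α) ≡ 0#
    trace-vanishes rd τᵢ≡τⱼ = trans (TrQ-+ _ α) (trans (cong₂ _+_ (R⇒TrQ≡τ j rd) (R⇒TrQ≡τ i rα)) (x≡y⇒x+y≡0 (sym τᵢ≡τⱼ)))
    pointwise : ∀ d → χ (T₀? (d + α)) *ℕ χ (R? j (α + (d + α))) ≡ δ i j *ℕ χ (R? j d)
    pointwise d rewrite solve 2 (λ d a → a :+ (d :+ a) := d) refl d α with R? j d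
    ... | yes rd = cong (_*ℕ 1) (χ-cong (T₀? (d + α)) (τ i ≟ τ j) (same-trace rd) (trace-vanishes rd))
    ... | no  _  = trans (ℕ.*-zeroʳ (χ (T₀? (d + α)))) (sym (ℕ.*-zeroʳ (δ i j)))

  ∑-overlapCount-φ : ∀ i j → ∑𝔽 (λ t → overlapCount i j (φ t)) ≡ 2 *ℕ (δ i j *ℕ #R j) *ℕ #R i
  ∑-overlapCount-φ i j = begin
    ∑𝔽 (λ t → overlapCount i j (φ t))                      ≡⟨ ∑-cong elements (λ t _ → ∑-cong elements (λ α _ → χ-× (R? i α) _)) ⟩
    ∑𝔽 (λ t → ∑𝔽 (λ α → χ (R? i α) *ℕ χ (R? j (α + φ t)))) ≡⟨ ∑-swap elements elements _ ⟩
    ∑𝔽 (λ α → ∑𝔽 (λ t → χ (R? i α) *ℕ χ (R? j (α + φ t)))) ≡⟨ ∑-cong elements (λ α _ → ∑-*-distribˡ elements (χ (R? i α)) _) ⟩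
    ∑𝔽 (λ α → χ (R? i α) *ℕ ∑𝔽 (λ t → χ (R? j (α + φ t)))) ≡⟨ ∑-cong elements (λ α _ → on-Rᵢ α (R? i α)) ⟩
    ∑𝔽 (λ α → χ (R? i α) *ℕ (2 *ℕ (δ i j *ℕ #R j)))        ≡⟨ ∑-*-distribʳ elements _ _ ⟩
    #R i *ℕ (2 *ℕ (δ i j *ℕ #R j))                         ≡⟨ ℕ.*-comm (#R i) _ ⟩
    2 *ℕ (δ i j *ℕ #R j) *ℕ #R i                           ∎
    where
    open ≡-Reasoning
    on-Rᵢ : ∀ α (r : Dec (R i α)) → χ r *ℕ ∑𝔽 (λ t → χ (R? j (α + φ t))) ≡ χ r *ℕ (2 *ℕ (δ i j *ℕ #R j))
    on-Rᵢ α (no  _)  = refl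
    on-Rᵢ α (yes rα) = cong (1 *ℕ_) (begin
      ∑𝔽 (λ t → χ (R? j (α + φ t)))                       ≡⟨ ∑𝔽-∘ φ (λ c → χ (R? j (α + c))) ⟩
      ∑𝔽 (λ c → #[ (λ t → φ t ≟ c) ] *ℕ χ (R? j (α + c))) ≡⟨ ∑-cong elements (λ c _ → cong (_*ℕ χ (R? j (α + c))) (φ-fibre c)) ⟩
      ∑𝔽 (λ c → 2 *ℕ χ (T₀? c) *ℕ χ (R? j (α + c)))       ≡⟨ ∑-cong elements (λ c _ → ℕ.*-assoc 2 (χ (T₀? c)) (χ (R? j (α + c)))) ⟩
      ∑𝔽 (λ c → 2 *ℕ (χ (T₀? c) *ℕ χ (R? j (α + c))))     ≡⟨ ∑-*-distribˡ elements 2 _ ⟩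
      2 *ℕ ∑𝔽 (λ c → χ (T₀? c) *ℕ χ (R? j (α + c)))       ≡⟨ cong (2 *ℕ_) (∑-T₀-translate i j rα) ⟩
      2 *ℕ (δ i j *ℕ #R j)                                   ∎)

  overlapCount-0# : ∀ i j → overlapCount i j 0# ≡ χ (i Fin.≟ j) *ℕ #R i
  overlapCount-0# i j = trans (∑-cong elements (λ α _ → pointwise α (R? i α) (R? j (α + 0#))))
    (∑-*-distribˡ elements (χ (i Fin.≟ j)) _)
    where
    pointwise : ∀ α (r : Dec (R i α)) (s : Dec (R j (α + 0#))) → χ (r ×-dec s) ≡ χ (i Fin.≟ j) *ℕ χ r
    pointwise α (no _)  s = sym (ℕ.*-zeroʳ (χ (i Fin.≟ j)))
    pointwise α (yes r) s = trans (χ-cong (yes r ×-dec s) (i Fin.≟ j) (λ (_ , s) → R-disjoint i j r (subst (R j) (+-identityʳ α) s))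
      (λ { refl → r , subst (R i) (sym (+-identityʳ α)) r })) (sym (ℕ.*-identityʳ _))

  normalCount-formula : ∀ i j →
    normalCount i j +ℕ χ (i Fin.≟ j) *ℕ #R i ≡ χ (R? i 0#) *ℕ χ (R? j 0#) *ℕ W +ℕ 2 *ℕ (δ i j *ℕ #R j) *ℕ #R i
  normalCount-formula i j = begin
    normalCount i j +ℕ χ (i Fin.≟ j) *ℕ #R i         ≡⟨ cong (normalCount i j +ℕ_) (sym (trans (cong (overlapCount i j) φ-0#) (overlapCount-0# i j))) ⟩
    normalCount i j +ℕ overlapCount i j (φ 0#)       ≡⟨ ∑𝔽-except 0# _ (overlapCount i j ∘ φ) (λ t → normalRow-≢0 i j) ⟩
    #[ Normal? i j 0# ] +ℕ ∑𝔽 (overlapCount i j ∘ φ) ≡⟨ cong₂ _+ℕ_ (normalRow-0# i j) (∑-overlapCount-φ i j) ⟩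
    χ (R? i 0#) *ℕ χ (R? j 0#) *ℕ W +ℕ 2 *ℕ (δ i j *ℕ #R j) *ℕ #R i ∎
    where open ≡-Reasoning

  record NormalCoordinates (ℓ m : Line) : Set where
    field
      Ψ Φ : Line → Line
      Φ∘Ψ : ∀ n → Φ (Ψ n) ≡ n
      Ψ∘Φ : ∀ p → Ψ (Φ p) ≡ p
      Ψℓ : Ψ ℓ ≡ (0# , 0#)
      Ψm : Ψ m ≡ (0# , 1#)
      ρ̂-ℓ : ∀ n → ρ̂ ℓ n ≡ proj₁ (Ψ n) * proj₂ (Ψ n)
      ρ̂-m : ∀ n → ρ̂ n m ≡ proj₁ (Ψ n) * proj₂ (Ψ n) + φ (proj₁ (Ψ n))

    Ψ-injective : ∀ {n n′} → Ψ n ≡ Ψ n′ → n ≡ n′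
    Ψ-injective {n} {n′} e = trans (sym (Φ∘Ψ n)) (trans (cong Φ e) (Φ∘Ψ n′))

  count≡normalCount : ∀ {ℓ m} → NormalCoordinates ℓ m → ∀ i j → count ℓ m i j ≡ normalCount i j
  count≡normalCount {ℓ} {m} nc i j = begin
    count ℓ m i j                                           ≡⟨ trans (length-filter≡∑χ _ lines)
                                                                 (∑-cong lines (λ n _ → χ-cong _ (Normal?′ (Ψ n)) to-normal from-normal)) ⟩
    ∑ lines (λ n → χ (Normal?′ (Ψ n))) ≡⟨ ∑-reindex lines-unique lines-complete Ψ Φ Φ∘Ψ Ψ∘Φ _ ⟩
    ∑ lines (λ p → χ (Normal?′ p))     ≡⟨ ∑-cartesianProduct elements elements _ ⟩
    normalCount i j                    ∎
    where
    open ≡-Reasoning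
    open NormalCoordinates nc
    P : Line → Set
    P n = n ≢ ℓ × n ≢ m × R i (ρ̂ ℓ n) × R j (ρ̂ n m)
    Normal?′ : ∀ p → Dec (Normal i j (proj₁ p) (proj₂ p))
    Normal?′ (t , v) = Normal? i j t v
    to-normal : ∀ {n} → P n → Normal i j (proj₁ (Ψ n)) (proj₂ (Ψ n))
    to-normal {n} (n≢ℓ , n≢m , r , s) =
      (λ e → n≢ℓ (Ψ-injective (trans e (sym Ψℓ)))) , (λ e → n≢m (Ψ-injective (trans e (sym Ψm)))) ,
      subst (R i) (ρ̂-ℓ n) r , subst (R j) (ρ̂-m n) s
    from-normal : ∀ {n} → Normal i j (proj₁ (Ψ n)) (proj₂ (Ψ n)) → P n
    from-normal {n} (≢00 , ≢01 , r , s) =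
      (λ { refl → ≢00 Ψℓ }) , (λ { refl → ≢01 Ψm }) , subst (R i) (sym (ρ̂-ℓ n)) r , subst (R j) (sym (ρ̂-m n)) s
    lines-unique : Unique lines
    lines-unique = Unique.cartesianProduct⁺ elements-unique elements-unique
    lines-complete : ∀ p → p ∈ lines
    lines-complete (x , y) = ∈-cartesianProduct⁺ (elements-complete x) (elements-complete y)

-- Normal coordinates for a pair of lines

module Coordinates (F : FiniteField) (h′ : ℕ)
  (char2 : FiniteField._+_ F (FiniteField.1# F) (FiniteField.1# F) ≡ FiniteField.0# F)
  (order≡q² : FiniteField.order F ≡ 2 ^ suc h′ *ℕ 2 ^ suc h′) where
  open import Relation.Binary.PropositionalEquality
  open import Algebra.Structures using (IsCommutativeRing)

  open FiniteField F
  open IsCommutativeRing isCommutativeRing using (+-identityʳ; *-identityʳ; zeroʳ)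
  open CharacteristicTwo F char2
  open Counting F
  open Conic F (suc h′)
  open QuadraticExtension F h′ char2 order≡q²
  open NormalForm F h′ char2 order≡q²

  -- The solver cannot use J ≡ 1 for a product J = A · A⁻¹: such identities are proved
  -- as polynomial identities in J and then specialised to J = 1.
  private
    substituting : ∀ {lhs rhs J : Carrier} (G : Carrier → Carrier) → J ≡ 1# → lhs ≡ G J → G 1# ≡ rhs → lhs ≡ rhs
    substituting G J≡1 lhs≡GJ G1≡rhs = trans lhs≡GJ (trans (cong G J≡1) G1≡rhs)

  module _ (x y a b : Carrier) (A≢0 : x + a ≢ 0#) (ρ̂≡0 : ρ̂ (x , y) (a , b) ≡ 0#) where
    private
      A B s I : Carrier
      A = x + a
      B = y + b
      s = x * b + y * a
      I = inv A A≢0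
      A·I≡1 : A * I ≡ 1#
      A·I≡1 = *-inverseʳ A A≢0

      -- t is the affine form vanishing at ℓ and m; the term x² t / A in v is what makes
      -- ρ̂(ℓ, n) = t v, and the final factor 1 / A normalises v(m) to 1.
      tᶠ : Line → Carrier
      tᶠ (z , u) = A * u + B * z + s
      Ψ : Line → Line
      Ψ (z , u) = tᶠ (z , u) , (z + x + x * x * tᶠ (z , u) * I) * I
      zᶠ : Carrier → Carrier → Carrier
      zᶠ t v = A * v + x + x * x * t * I
      Φ : Line → Line
      Φ (t , v) = zᶠ t v , (s + t + B * zᶠ t v) * I

      Φ∘Ψ : ∀ n → Φ (Ψ n) ≡ n
      Φ∘Ψ (z , u) = cong₂ _,_ first (trans (cong (λ w → (s + t + B * w) * I) first) second)
        where
        t : Carrier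
        t = tᶠ (z , u)
        first : zᶠ t ((z + x + x * x * t * I) * I) ≡ z
        first = substituting (λ J → J * (z + x + x * x * t * I) + x + x * x * t * I) A·I≡1
          (solve 5 (λ A z x t I → A :* ((z :+ x :+ x :* x :* t :* I) :* I) :+ x :+ x :* x :* t :* I := (A :* I) :* (z :+ x :+ x :* x :* t :* I) :+ x :+ x :* x :* t :* I) refl A z x t I)
          (solve 4 (λ z x t I → con true :* (z :+ x :+ x :* x :* t :* I) :+ x :+ x :* x :* t :* I := z) refl z x t I)
        second : (s + t + B * z) * I ≡ u
        second = substituting (λ J → u * J) A·I≡1
          (solve 7 (λ x y a b z u I → ((x :* b :+ y :* a) :+ ((x :+ a) :* u :+ (y :+ b) :* z :+ (x :* b :+ y :* a)) :+ (y :+ b) :* z) :* I := u :* ((x :+ a) :* I)) refl x y a b z u I)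
          (*-identityʳ u)

      Ψ∘Φ : ∀ p → Ψ (Φ p) ≡ p
      Ψ∘Φ (t , v) = cong₂ _,_ first (trans (cong (λ w → (z + x + x * x * w * I) * I) first) second)
        where
        z : Carrier
        z = zᶠ t v
        w : Carrier
        w = s + t + B * z
        first : tᶠ (Φ (t , v)) ≡ t
        first = substituting (λ J → J * w + B * z + s) A·I≡1
          (solve 5 (λ A w I bz s → A :* (w :* I) :+ bz :+ s := (A :* I) :* w :+ bz :+ s) refl A w I (B * z) s)
          (solve 3 (λ s t bz → con true :* (s :+ t :+ bz) :+ bz :+ s := t) refl s t (B * z))
        second : (z + x + x * x * t * I) * I ≡ v
        second = substituting (λ J → v * J) A·I≡1
          (solve 5 (λ A v x t I → (A :* v :+ x :+ x :* x :* t :* I :+ x :+ x :* x :* t :* I) :* I := v :* (A :* I)) refl A v x t I)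
          (*-identityʳ v)

      Ψℓ : Ψ (x , y) ≡ (0# , 0#)
      Ψℓ = cong₂ _,_ t≡0 (trans (cong (λ w → (x + x + x * x * w * I) * I) t≡0)
        (solve 2 (λ x I → (x :+ x :+ x :* x :* con false :* I) :* I := con false) refl x I))
        where
        t≡0 : tᶠ (x , y) ≡ 0#
        t≡0 = solve 4 (λ x y a b → (x :+ a) :* y :+ (y :+ b) :* x :+ (x :* b :+ y :* a) := con false) refl x y a b

      Ψm : Ψ (a , b) ≡ (0# , 1#)
      Ψm = cong₂ _,_ t≡0 (trans (cong (λ w → (a + x + x * x * w * I) * I) t≡0)
        (trans (solve 3 (λ x a I → (a :+ x :+ x :* x :* con false :* I) :* I := (x :+ a) :* I) refl x a I) A·I≡1))
        where
        t≡0 : tᶠ (a , b) ≡ 0#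
        t≡0 = solve 4 (λ x y a b → (x :+ a) :* b :+ (y :+ b) :* a :+ (x :* b :+ y :* a) := con false) refl x y a b

      A²≢0 : A * A ≢ 0#
      A²≢0 = *-≢0 A≢0 A≢0

      -- A² ρ̂(ℓ, n) = t (A z + A x + x² t) + (z² + x²) ρ̂(ℓ, m), and ρ̂(ℓ, m) = 0.
      ρ̂-ℓ : ∀ n → ρ̂ (x , y) n ≡ proj₁ (Ψ n) * proj₂ (Ψ n)
      ρ̂-ℓ (z , u) = *-cancelˡ A²≢0 (trans expand (sym contract))
        where
        t : Carrier
        t = tᶠ (z , u)
        expand : A * A * ρ̂ (x , y) (z , u) ≡ t * (A * z + A * x + x * x * t)
        expand = trans (solve 6 (λ x y a b z u →
                   (x :+ a) :* (x :+ a) :* ((x :* (x :* con true)) :* (u :* (u :* con true)) :+ (y :* (y :* con true)) :* (z :* (z :* con true)) :+ (x :+ z) :* (y :+ u))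
                   := ((x :+ a) :* u :+ (y :+ b) :* z :+ (x :* b :+ y :* a)) :* ((x :+ a) :* z :+ (x :+ a) :* x :+ x :* x :* ((x :+ a) :* u :+ (y :+ b) :* z :+ (x :* b :+ y :* a)))
                      :+ (z :* z :+ x :* x) :* ((x :* (x :* con true)) :* (b :* (b :* con true)) :+ (y :* (y :* con true)) :* (a :* (a :* con true)) :+ (x :+ a) :* (y :+ b)))
                   refl x y a b z u)
                 (trans (cong (λ r → t * (A * z + A * x + x * x * t) + (z * z + x * x) * r) ρ̂≡0)
                   (trans (cong (t * (A * z + A * x + x * x * t) +_) (zeroʳ _)) (+-identityʳ _)))
        contract : A * A * (t * ((z + x + x * x * t * I) * I)) ≡ t * (A * z + A * x + x * x * t)
        contract = substituting (λ J → t * (J * (A * z + A * x) + x * x * t * (J * J))) A·I≡1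
          (solve 5 (λ A t z x I → A :* A :* (t :* ((z :+ x :+ x :* x :* t :* I) :* I)) := t :* ((A :* I) :* (A :* z :+ A :* x) :+ x :* x :* t :* ((A :* I) :* (A :* I)))) refl A t z x I)
          (solve 4 (λ A t z x → t :* (con true :* (A :* z :+ A :* x) :+ x :* x :* t :* (con true :* con true)) := t :* (A :* z :+ A :* x :+ x :* x :* t)) refl A t z x)

      ρ̂-m : ∀ n → ρ̂ n (a , b) ≡ proj₁ (Ψ n) * proj₂ (Ψ n) + φ (proj₁ (Ψ n))
      ρ̂-m (z , u) = trans split (cong (λ r → r + φ (tᶠ (z , u))) (ρ̂-ℓ (z , u)))
        where
        split : ρ̂ (z , u) (a , b) ≡ ρ̂ (x , y) (z , u) + φ (tᶠ (z , u))
        split = trans (solve 6 (λ x y a b z u →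
                  (z :* (z :* con true)) :* (b :* (b :* con true)) :+ (u :* (u :* con true)) :* (a :* (a :* con true)) :+ (z :+ a) :* (u :+ b)
                  := ((x :* (x :* con true)) :* (u :* (u :* con true)) :+ (y :* (y :* con true)) :* (z :* (z :* con true)) :+ (x :+ z) :* (y :+ u))
                     :+ (((x :+ a) :* u :+ (y :+ b) :* z :+ (x :* b :+ y :* a)) :* ((x :+ a) :* u :+ (y :+ b) :* z :+ (x :* b :+ y :* a)) :+ ((x :+ a) :* u :+ (y :+ b) :* z :+ (x :* b :+ y :* a)))
                     :+ ((x :* (x :* con true)) :* (b :* (b :* con true)) :+ (y :* (y :* con true)) :* (a :* (a :* con true)) :+ (x :+ a) :* (y :+ b)))
                  refl x y a b z u)
                (trans (cong (ρ̂ (x , y) (z , u) + φ (tᶠ (z , u)) +_) ρ̂≡0) (+-identityʳ _))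

      -- With ξ = s / A, the relation ρ̂(ℓ, m) = 0 gives c ξ² + ξ + d = 0 for (c, d) = ℓ and for
      -- (c, d) = m, whence c d = (c ξ)² + c ξ has trace 0.
      ξ : Carrier
      ξ = s * I

      secant-from : ∀ c d → A * A * (c * ξ * ξ + ξ + d) ≡ c * ρ̂ (x , y) (a , b) → TrQ (c * d) ≡ 0#
      secant-from c d e = trans (cong TrQ c·d≡φ[cξ]) (TrQ-artinSchreier (c * ξ))
        where
        root : c * ξ * ξ + ξ + d ≡ 0#
        root = *-cancelˡ A²≢0 (trans e (trans (cong (c *_) ρ̂≡0) (trans (zeroʳ c) (sym (zeroʳ (A * A))))))
        c·d≡φ[cξ] : c * d ≡ φ (c * ξ)
        c·d≡φ[cξ] = trans (solve 3 (λ c ξ d → c :* d := (c :* ξ) :* (c :* ξ) :+ c :* ξ :+ c :* (c :* ξ :* ξ :+ ξ :+ d)) refl c ξ d)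
                      (trans (cong (φ (c * ξ) +_) (trans (cong (c *_) root) (zeroʳ c))) (+-identityʳ _))

    normalCoordinates-x≢a : NormalCoordinates (x , y) (a , b)
    normalCoordinates-x≢a = record { Ψ = Ψ ; Φ = Φ ; Φ∘Ψ = Φ∘Ψ ; Ψ∘Φ = Ψ∘Φ ; Ψℓ = Ψℓ ; Ψm = Ψm ; ρ̂-ℓ = ρ̂-ℓ ; ρ̂-m = ρ̂-m }

    secant-x≢a : Secant (x , y) × Secant (a , b)
    secant-x≢a =
      secant-from x y (substituting (λ J → x * s * s * (J * J) + A * s * J + A * A * y) A·I≡1
        (solve 5 (λ A x s I y → A :* A :* (x :* (s :* I) :* (s :* I) :+ s :* I :+ y) := x :* s :* s :* ((A :* I) :* (A :* I)) :+ A :* s :* (A :* I) :+ A :* A :* y) refl A x s I y)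
        (solve 4 (λ x y a b → x :* (x :* b :+ y :* a) :* (x :* b :+ y :* a) :* (con true :* con true) :+ (x :+ a) :* (x :* b :+ y :* a) :* con true :+ (x :+ a) :* (x :+ a) :* y
            := x :* ((x :* (x :* con true)) :* (b :* (b :* con true)) :+ (y :* (y :* con true)) :* (a :* (a :* con true)) :+ (x :+ a) :* (y :+ b))) refl x y a b)) ,
      secant-from a b (substituting (λ J → a * s * s * (J * J) + A * s * J + A * A * b) A·I≡1
        (solve 5 (λ A x s I y → A :* A :* (x :* (s :* I) :* (s :* I) :+ s :* I :+ y) := x :* s :* s :* ((A :* I) :* (A :* I)) :+ A :* s :* (A :* I) :+ A :* A :* y) refl A a s I b)
        (solve 4 (λ x y a b → a :* (x :* b :+ y :* a) :* (x :* b :+ y :* a) :* (con true :* con true) :+ (x :+ a) :* (x :* b :+ y :* a) :* con true :+ (x :+ a) :* (x :+ a) :* b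
            := a :* ((x :* (x :* con true)) :* (b :* (b :* con true)) :+ (y :* (y :* con true)) :* (a :* (a :* con true)) :+ (x :+ a) :* (y :+ b))) refl x y a b))

  module _ (y b : Carrier) (B≢0 : y + b ≢ 0#) where
    private
      B I : Carrier
      B = y + b
      I = inv B B≢0
      B·I≡1 : B * I ≡ 1#
      B·I≡1 = *-inverseʳ B B≢0

      Ψ : Line → Line
      Ψ (z , u) = B * z , (u + y + y * y * (B * z) * I) * I
      Φ : Line → Line
      Φ (t , v) = t * I , B * v + y + y * y * t * I

      Φ∘Ψ : ∀ n → Φ (Ψ n) ≡ n
      Φ∘Ψ (z , u) = cong₂ _,_
        (substituting (λ K → z * K) B·I≡1 (solve 3 (λ B z I → B :* z :* I := z :* (B :* I)) refl B z I) (*-identityʳ z))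
        (substituting (λ K → K * w + y + c) B·I≡1
          (solve 5 (λ B w I y c → B :* (w :* I) :+ y :+ c := (B :* I) :* w :+ y :+ c) refl B w I y c)
          (solve 4 (λ u y t I → con true :* (u :+ y :+ y :* y :* t :* I) :+ y :+ y :* y :* t :* I := u) refl u y (B * z) I))
        where
        w : Carrier
        w = u + y + y * y * (B * z) * I
        c : Carrier
        c = y * y * (B * z) * I

      Ψ∘Φ : ∀ p → Ψ (Φ p) ≡ p
      Ψ∘Φ (t , v) = cong₂ _,_ first (trans (cong (λ r → (B * v + y + y * y * t * I + y + y * y * r * I) * I) first) second)
        where
        first : B * (t * I) ≡ t
        first = substituting (λ K → t * K) B·I≡1 (solve 3 (λ B t I → B :* (t :* I) := t :* (B :* I)) refl B t I) (*-identityʳ t)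
        second : (B * v + y + y * y * t * I + y + y * y * t * I) * I ≡ v
        second = substituting (λ K → v * K) B·I≡1
          (solve 5 (λ B v y t I → (B :* v :+ y :+ y :* y :* t :* I :+ y :+ y :* y :* t :* I) :* I := v :* (B :* I)) refl B v y t I)
          (*-identityʳ v)

      Ψℓ : Ψ (0# , y) ≡ (0# , 0#)
      Ψℓ = cong₂ _,_ (zeroʳ B) (trans (cong (λ r → (y + y + y * y * r * I) * I) (zeroʳ B))
        (solve 2 (λ y I → (y :+ y :+ y :* y :* con false :* I) :* I := con false) refl y I))

      Ψm : Ψ (0# , b) ≡ (0# , 1#)
      Ψm = cong₂ _,_ (zeroʳ B) (trans (cong (λ r → (b + y + y * y * r * I) * I) (zeroʳ B))
        (trans (solve 3 (λ y b I → (b :+ y :+ y :* y :* con false :* I) :* I := (y :+ b) :* I) refl y b I) B·I≡1))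

      ρ̂-ℓ : ∀ n → ρ̂ (0# , y) n ≡ proj₁ (Ψ n) * proj₂ (Ψ n)
      ρ̂-ℓ (z , u) = sym (substituting (λ K → z * K * (u + y) + y * y * z * z * (K * K)) B·I≡1
        (solve 5 (λ B z u y I → B :* z :* ((u :+ y :+ y :* y :* (B :* z) :* I) :* I) := z :* (B :* I) :* (u :+ y) :+ y :* y :* z :* z :* ((B :* I) :* (B :* I))) refl B z u y I)
        (solve 3 (λ z u y → z :* con true :* (u :+ y) :+ y :* y :* z :* z :* (con true :* con true)
            := (con false :* (con false :* con true)) :* (u :* (u :* con true)) :+ (y :* (y :* con true)) :* (z :* (z :* con true)) :+ (con false :+ z) :* (y :+ u)) refl z u y))

      ρ̂-m : ∀ n → ρ̂ n (0# , b) ≡ proj₁ (Ψ n) * proj₂ (Ψ n) + φ (proj₁ (Ψ n))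
      ρ̂-m (z , u) = trans split (cong (λ r → r + φ (B * z)) (ρ̂-ℓ (z , u)))
        where
        split : ρ̂ (z , u) (0# , b) ≡ ρ̂ (0# , y) (z , u) + φ (B * z)
        split = solve 4 (λ y b z u →
                  (z :* (z :* con true)) :* (b :* (b :* con true)) :+ (u :* (u :* con true)) :* (con false :* (con false :* con true)) :+ (z :+ con false) :* (u :+ b)
                  := ((con false :* (con false :* con true)) :* (u :* (u :* con true)) :+ (y :* (y :* con true)) :* (z :* (z :* con true)) :+ (con false :+ z) :* (y :+ u))
                     :+ (((y :+ b) :* z) :* ((y :+ b) :* z) :+ (y :+ b) :* z)) refl y b z u

    normalCoordinates-x≡a≡0 : NormalCoordinates (0# , y) (0# , b)
    normalCoordinates-x≡a≡0 = record { Ψ = Ψ ; Φ = Φ ; Φ∘Ψ = Φ∘Ψ ; Ψ∘Φ = Ψ∘Φ ; Ψℓ = Ψℓ ; Ψm = Ψm ; ρ̂-ℓ = ρ̂-ℓ ; ρ̂-m = ρ̂-m }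

  ρ̂-x≡a : ∀ x y b → ρ̂ (x , y) (x , b) ≡ (x * (y + b)) * (x * (y + b))
  ρ̂-x≡a = solve 3 (λ x y b → (x :* (x :* con true)) :* (b :* (b :* con true)) :+ (y :* (y :* con true)) :* (x :* (x :* con true)) :+ (x :+ x) :* (y :+ b)
                       := (x :* (y :+ b)) :* (x :* (y :+ b))) refl

-- The entries of the matrix

module Arithmetic where
  open import Data.Nat using (zero; _+_; _*_; _∸_; _/_)
  open import Data.Nat.DivMod using (m*n/n≡m)
  open import Data.Nat.Tactic.RingSolver using (solve)
  open import Data.List using ([]; _∷_)
  open import Relation.Binary.PropositionalEquality

  module _ (n : ℕ) where
    qₙ halfₙ Wₙ : ℕ
    qₙ    = 2 + (n + n)
    halfₙ = 2 * suc n * suc n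
    Wₙ    = 2 + 4 * n * (n + 2)

    size : Fin 5 → ℕ
    size ι₁ = n
    size ι₂ = suc n
    size ι₃ = 2 * n * suc n
    size ι₄ = 1
    size ι₅ = halfₙ

    rhs : Fin 5 → Fin 5 → ℕ
    rhs i j = χ (i Fin.≟ ι₄) * χ (j Fin.≟ ι₄) * Wₙ + 2 * (χ (isι₅ i Bool.≟ isι₅ j) * size j) * size i

  qₙ²≡2·halfₙ : ∀ n → (2 + (n + n)) * (2 + (n + n)) ≡ 2 * (2 * suc n * suc n)
  qₙ²≡2·halfₙ n = solve (n ∷ [])

  halfₙ≡qₙ+size₃ : ∀ n → 2 * suc n * suc n ≡ (2 + (n + n)) + 2 * n * suc n
  halfₙ≡qₙ+size₃ n = solve (n ∷ [])

  qₙ²≡Wₙ+2 : ∀ n → (2 + (n + n)) * (2 + (n + n)) ≡ (2 + 4 * n * (n + 2)) + 2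
  qₙ²≡Wₙ+2 n = solve (n ∷ [])

  halve : ∀ {x c r} h → x ≡ h * 2 → h + c ≡ r → x / 2 + c ≡ r
  halve {c = c} h x≡2h h+c≡r = trans (cong (λ x → x / 2 + c) x≡2h) (trans (cong (_+ c) (m*n/n≡m h 2)) h+c≡r)

  r-at-2m+4 : ∀ m → (2 + (suc m + suc m)) * (2 + (suc m + suc m)) ∸ 2 * (2 + (suc m + suc m)) ∸ 1 ≡ 7 + (4 * m * m + 12 * m)
  r-at-2m+4 m = cong (_∸ 1) (trans (cong (_∸ 2 * (2 + (suc m + suc m))) q²≡) (ℕ.m+n∸n≡m (8 + (4 * m * m + 12 * m)) (2 * (2 + (suc m + suc m)))))
    where
    q²≡ : (2 + (suc m + suc m)) * (2 + (suc m + suc m)) ≡ (8 + (4 * m * m + 12 * m)) + 2 * (2 + (suc m + suc m))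
    q²≡ = solve (m ∷ [])

  -- The ring solver only sees the displayed terms, so each case spells out the numerator x of
  -- the entry x / 2, its half h, and the reduced forms of both sides.
  pMatrix-spec : ∀ n i j → pMatrix (qₙ n) i j + χ (i Fin.≟ j) * size n i ≡ rhs n i j
  pMatrix-spec zero ι₁ ι₁ = refl
  pMatrix-spec (suc m) ι₁ ι₁ =
    halve {x = (suc m + suc m) * (m + suc m)} {c = 1 * suc m} {r = 2 * (1 * suc m) * suc m}
      (suc m * (m + suc m)) (solve (m ∷ [])) (solve (m ∷ []))
  pMatrix-spec n ι₁ ι₂ =
    halve {x = (2 + (n + n)) * (n + n)} {c = 0} {r = 2 * (1 * suc n) * n}
      (suc n * (n + n)) (solve (n ∷ [])) (solve (n ∷ []))
  pMatrix-spec n ι₂ ι₁ =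
    halve {x = (2 + (n + n)) * (n + n)} {c = 0} {r = 2 * (1 * n) * suc n}
      (suc n * (n + n)) (solve (n ∷ [])) (solve (n ∷ []))
  pMatrix-spec n ι₁ ι₃ =
    halve {x = (2 + (n + n)) * ((n + n) * (n + n))} {c = 0} {r = 2 * (1 * (2 * n * suc n)) * n}
      (suc n * ((n + n) * (n + n))) (solve (n ∷ [])) (solve (n ∷ []))
  pMatrix-spec n ι₃ ι₁ =
    halve {x = (2 + (n + n)) * ((n + n) * (n + n))} {c = 0} {r = 2 * (1 * n) * (2 * n * suc n)}
      (suc n * ((n + n) * (n + n))) (solve (n ∷ [])) (solve (n ∷ []))
  pMatrix-spec n ι₂ ι₂ =
    halve {x = (2 + (n + n)) * (1 + (n + n))} {c = 1 * suc n} {r = 2 * (1 * suc n) * suc n}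
      (suc n * (1 + (n + n))) (solve (n ∷ [])) (solve (n ∷ []))
  pMatrix-spec n ι₂ ι₃ =
    halve {x = (2 + (n + n)) * (2 + (n + n)) * (n + n)} {c = 0} {r = 2 * (1 * (2 * n * suc n)) * suc n}
      (suc n * ((2 + (n + n)) * (n + n))) (solve (n ∷ [])) (solve (n ∷ []))
  pMatrix-spec n ι₃ ι₂ =
    halve {x = (2 + (n + n)) * (2 + (n + n)) * (n + n)} {c = 0} {r = 2 * (1 * suc n) * (2 * n * suc n)}
      (suc n * ((2 + (n + n)) * (n + n))) (solve (n ∷ [])) (solve (n ∷ []))
  pMatrix-spec zero ι₃ ι₃ = refl
  pMatrix-spec (suc m) ι₃ ι₃ =
    trans (cong (λ r → (2 + (suc m + suc m)) * (suc m + suc m) * r / 2 + 1 * (2 * suc m * suc (suc m))) (r-at-2m+4 m))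
      (halve {x = (2 + (suc m + suc m)) * (suc m + suc m) * (7 + (4 * m * m + 12 * m))} {c = 1 * (2 * suc m * suc (suc m))}
             {r = 2 * (1 * (2 * suc m * suc (suc m))) * (2 * suc m * suc (suc m))}
        (suc (suc m) * (suc m + suc m) * (7 + (4 * m * m + 12 * m))) (solve (m ∷ [])) (solve (m ∷ [])))
  pMatrix-spec n ι₅ ι₅ =
    halve {x = (2 + (n + n)) * (2 + (n + n)) * ((1 + (n + n)) + (1 + (n + n)) * (2 + (n + n)))} {c = 1 * (2 * suc n * suc n)}
          {r = 2 * (1 * (2 * suc n * suc n)) * (2 * suc n * suc n)}
      ((2 * suc n * suc n) * ((1 + (n + n)) + (1 + (n + n)) * (2 + (n + n)))) (solve (n ∷ [])) (solve (n ∷ []))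
  pMatrix-spec n ι₁ ι₄ = e
    where
    e : n + n + 0 ≡ 2 * (1 * 1) * n
    e = solve (n ∷ [])
  pMatrix-spec n ι₄ ι₁ = e
    where
    e : n + n + 0 ≡ 2 * (1 * n) * 1
    e = solve (n ∷ [])
  pMatrix-spec n ι₂ ι₄ = e
    where
    e : 2 + (n + n) + 0 ≡ 2 * (1 * 1) * suc n
    e = solve (n ∷ [])
  pMatrix-spec n ι₄ ι₂ = e
    where
    e : 2 + (n + n) + 0 ≡ 2 * (1 * suc n) * 1
    e = solve (n ∷ [])
  pMatrix-spec n ι₃ ι₄ = e
    where
    e : (2 + (n + n)) * (n + n) + 0 ≡ 2 * (1 * 1) * (2 * n * suc n)
    e = solve (n ∷ [])
  pMatrix-spec n ι₄ ι₃ = e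
    where
    e : (2 + (n + n)) * (n + n) + 0 ≡ 2 * (1 * (2 * n * suc n)) * 1
    e = solve (n ∷ [])
  pMatrix-spec n ι₄ ι₄ = e
    where
    e : (1 + (n + n)) + (1 + (n + n)) * (2 + (n + n)) + 1 * 1 ≡ 1 * 1 * (2 + 4 * n * (n + 2)) + 2 * (1 * 1) * 1
    e = solve (n ∷ [])
  pMatrix-spec n ι₁ ι₅ = refl
  pMatrix-spec n ι₂ ι₅ = refl
  pMatrix-spec n ι₃ ι₅ = refl
  pMatrix-spec n ι₄ ι₅ = refl
  pMatrix-spec n ι₅ ι₁ = refl
  pMatrix-spec n ι₅ ι₂ = refl
  pMatrix-spec n ι₅ ι₃ = refl
  pMatrix-spec n ι₅ ι₄ = refl

open Arithmetic

module Theorem (F : FiniteField) (h′ : ℕ)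
  (char2 : FiniteField._+_ F (FiniteField.1# F) (FiniteField.1# F) ≡ FiniteField.0# F)
  (order≡q² : FiniteField.order F ≡ 2 ^ suc h′ *ℕ 2 ^ suc h′) where
  open import Data.Empty using (⊥-elim)
  open import Data.Nat using (pred) renaming (_+_ to _+ℕ_)
  open import Data.Sum using (inj₁; inj₂)
  open import Relation.Nullary using (yes; no)
  open import Relation.Binary.PropositionalEquality
  open import Algebra.Structures using (IsCommutativeRing)

  open FiniteField F
  open IsCommutativeRing isCommutativeRing using (zeroˡ)
  open CharacteristicTwo F char2
  open Counting F
  open Conic F (suc h′)
  open QuadraticExtension F h′ char2 order≡q²
  open NormalForm F h′ char2 order≡q²
  open Coordinates F h′ char2 order≡q²

  n : ℕ
  n = pred k

  k≡1+n : k ≡ suc n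
  k≡1+n = 2^n≡suc h′

  q≡2+2n : q ≡ qₙ n
  q≡2+2n = trans (cong (k +ℕ_) (ℕ.+-identityʳ k)) (trans (cong (λ m → m +ℕ m) k≡1+n) (cong suc (ℕ.+-suc n n)))

  order≡qₙ² : order ≡ qₙ n *ℕ qₙ n
  order≡qₙ² = trans order≡q² (cong (λ m → m *ℕ m) q≡2+2n)

  2ᵉ≡halfₙ : 2 ^ e ≡ halfₙ n
  2ᵉ≡halfₙ = ℕ.*-cancelˡ-≡ _ _ 2 (trans (sym order≡2^[1+e]) (trans order≡qₙ² (qₙ²≡2·halfₙ n)))

  #R≡size : ∀ i → #R i ≡ size n i
  #R≡size ι₁ = ℕ.suc-injective (trans 1+|R₁|≡k k≡1+n)
  #R≡size ι₂ = trans |R₂|≡k k≡1+n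
  #R≡size ι₃ = ℕ.+-cancelˡ-≡ (qₙ n) _ _
    (trans (cong (_+ℕ #R ι₃) (sym q≡2+2n)) (trans q+|R₃|≡2ᵉ (trans 2ᵉ≡halfₙ (halfₙ≡qₙ+size₃ n))))
  #R≡size ι₄ = |R₄|≡1
  #R≡size ι₅ = trans |R₅|≡2ᵉ 2ᵉ≡halfₙ

  W≡Wₙ : W ≡ Wₙ n
  W≡Wₙ = ℕ.+-cancelʳ-≡ 2 _ _ (trans W+2≡order (trans order≡qₙ² (qₙ²≡Wₙ+2 n)))

  χ-R-0# : ∀ i → χ (R? i 0#) ≡ χ (i Fin.≟ ι₄)
  χ-R-0# i = χ-cong (R? i 0#) (i Fin.≟ ι₄) (λ r → R-disjoint i ι₄ r refl) (λ { refl → refl })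

  δ≡ : ∀ i j → δ i j ≡ χ (isι₅ i Bool.≟ isι₅ j)
  δ≡ i j = χ-cong (τ i ≟ τ j) (isι₅ i Bool.≟ isι₅ j) fromBool-injective (cong fromBool)

  normalCount≡pMatrix : ∀ i j → normalCount i j ≡ pMatrix q i j
  normalCount≡pMatrix i j = begin
    normalCount i j    ≡⟨ ℕ.+-cancelʳ-≡ (χ (i Fin.≟ j) *ℕ size n i) _ _ (trans both-sides (sym (pMatrix-spec n i j))) ⟩
    pMatrix (qₙ n) i j ≡⟨ cong (λ m → pMatrix m i j) (sym q≡2+2n) ⟩
    pMatrix q i j      ∎
    where
    open ≡-Reasoning
    both-sides : normalCount i j +ℕ χ (i Fin.≟ j) *ℕ size n i ≡ rhs n i j
    both-sides = begin
      normalCount i j +ℕ χ (i Fin.≟ j) *ℕ size n i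
        ≡⟨ cong (λ s → normalCount i j +ℕ χ (i Fin.≟ j) *ℕ s) (sym (#R≡size i)) ⟩
      normalCount i j +ℕ χ (i Fin.≟ j) *ℕ #R i
        ≡⟨ normalCount-formula i j ⟩
      χ (R? i 0#) *ℕ χ (R? j 0#) *ℕ W +ℕ 2 *ℕ (δ i j *ℕ #R j) *ℕ #R i
        ≡⟨ cong₂ _+ℕ_ (cong₂ _*ℕ_ (cong₂ _*ℕ_ (χ-R-0# i) (χ-R-0# j)) W≡Wₙ)
                      (cong₂ _*ℕ_ (cong (2 *ℕ_) (cong₂ _*ℕ_ (δ≡ i j) (#R≡size j))) (#R≡size i)) ⟩
      rhs n i j ∎

  normalCoordinates : ∀ ℓ m → ℓ ≢ m → ρ̂ ℓ m ≡ 0# → NormalCoordinates ℓ m × Secant ℓ × Secant m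
  normalCoordinates (x , y) (a , b) ℓ≢m ρ̂≡0 with (x + a) ≟ 0#
  ... | no x≢a = normalCoordinates-x≢a x y a b x≢a ρ̂≡0 , secant-x≢a x y a b x≢a ρ̂≡0
  ... | yes x+a≡0 with x+y≡0⇒x≡y x+a≡0
  ... | refl with (y + b) ≟ 0#
  ... | yes y+b≡0 = ⊥-elim (ℓ≢m (cong (x ,_) (x+y≡0⇒x≡y y+b≡0)))
  ... | no y≢b with x*y≡0⇒x≡0⊎y≡0 (x*x≡0⇒x≡0 (trans (sym (ρ̂-x≡a x y b)) ρ̂≡0))
  ... | inj₂ y+b≡0 = ⊥-elim (y≢b y+b≡0)
  ... | inj₁ refl = normalCoordinates-x≡a≡0 y b y≢b , trans (cong TrQ (zeroˡ y)) TrQ-0# , trans (cong TrQ (zeroˡ b)) TrQ-0#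

  theorem : ∀ ℓ m → ℓ ≢ m → ρ̂ ℓ m ≡ 0# → (Secant ℓ × Secant m) × ((i j : Fin 5) → count ℓ m i j ≡ pMatrix q i j)
  theorem ℓ m ℓ≢m ρ̂≡0 with normalCoordinates ℓ m ℓ≢m ρ̂≡0
  ... | coordinates , secant = secant , λ i j → trans (count≡normalCount coordinates i j) (normalCount≡pMatrix i j)

mainTheorem17 : (h : ℕ) → h ≥ 1 → (F : FiniteField) →
    let open FiniteField F
        open Conic F h
    in 1# + 1# ≡ 0# → order ≡ q ^ 2 →
       (ℓ m : Line) → ℓ ≢ m → ρ̂ ℓ m ≡ 0# →
       (Secant ℓ × Secant m) ×
       ((i j : Fin 5) → count ℓ m i j ≡ pMatrix q i j)
mainTheorem17 (suc h′) (s≤s z≤n) F char2 order≡q^2 =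
  Theorem.theorem F h′ char2 (trans order≡q^2 (cong (2 ^ suc h′ *ℕ_) (ℕ.*-identityʳ _)))
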